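{- Let $f=f(x_1,\ldots,x_n)$ be a positive threshold non-split Boolean function with $k$ relevant variables, such that for every $i\in[n]$ at least one of the restrictions $f_{|x_i=0}$ and $f_{|x_i=1}$ is non-split. Then the number of extremal points of $f$ is at least $k+2$.
   Context: $B=\{0,1\}$; for $x,y\in B^n$, $x\preceq y$ means $(x)_j=1$ implies $(y)_j=1$. $f$ is positive if $f(x)=1$ and $x\preceq y$ imply $f(y)=1$; threshold if there are reals $w_1,\dots,w_n,t$ with $f(x)=0\iff\sum_jw_jx_j\le t$. For a variable $x_j$ and $\alpha\in B$, $g_{|x_j=\alpha}$ is the function of the remaining variables obtained by fixing $x_j=\alpha$. A variable $x_j$ is relevant for $g$ if $g_{|x_j=0}\not\equiv g_{|x_j=1}$. $g$ is split if it has a variable $x_j$ with $g_{|x_j=0}\equiv 0$ or $g_{|x_j=1}\equiv 1$; otherwise non-split. Extremal points of a positive function are its $\preceq$-maximal false points and $\preceq$-minimal true points.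
   Formalization: The weights $w_1,\dots,w_n$ and the threshold $t$ in the threshold representation of f are rational rather than real. -}

module Defs where

open import Data.Bool using (Bool; true; false)
open import Data.Nat using (ℕ; suc)
open import Data.Fin using (Fin)
open import Data.Vec using (Vec; []; _∷_; lookup; insertAt)
open import Data.Rational using (ℚ; 0ℚ; _+_; _≤_)
open import Data.Product using (Σ; _×_)
open import Relation.Binary.PropositionalEquality using (_≡_)
open import Relation.Nullary using (¬_)
open import Function.Bundles using (_⇔_)

BF : ℕ → Set
BF n = Vec Bool n → Bool

_⪯_ : ∀ {n} → Vec Bool n → Vec Bool n → Set
x ⪯ y = ∀ j → lookup x j ≡ true → lookup y j ≡ true

Positive : ∀ {n} → BF n → Set
Positive f = ∀ x y → f x ≡ true → x ⪯ y → f y ≡ true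

weighted : ∀ {n} → Vec ℚ n → Vec Bool n → ℚ
weighted []       []           = 0ℚ
weighted (w ∷ ws) (true  ∷ xs) = w + weighted ws xs
weighted (w ∷ ws) (false ∷ xs) = weighted ws xs

Threshold : ∀ {n} → BF n → Set
Threshold {n} f = Σ (Vec ℚ n) λ w → Σ ℚ λ t →
  ∀ x → (f x ≡ false) ⇔ (weighted w x ≤ t)

restrict : ∀ {n} → BF (suc n) → Fin (suc n) → Bool → BF n
restrict g j α x = g (insertAt x j α)

≡0 : ∀ {n} → BF n → Set
≡0 g = ∀ x → g x ≡ false

≡1 : ∀ {n} → BF n → Set
≡1 g = ∀ x → g x ≡ true

Relevant : ∀ {n} → BF (suc n) → Fin (suc n) → Set
Relevant g j = ¬ (∀ x → restrict g j false x ≡ restrict g j true x)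

NonSplit : ∀ {n} → BF n → Set
NonSplit {0}     g = Data.Unit.⊤ where import Data.Unit
NonSplit {suc n} g = ∀ j → ¬ ≡0 (restrict g j false) × ¬ ≡1 (restrict g j true)

MaximalFalse : ∀ {n} → BF n → Vec Bool n → Set
MaximalFalse f x = f x ≡ false × (∀ y → x ⪯ y → ¬ x ≡ y → f y ≡ true)

MinimalTrue : ∀ {n} → BF n → Vec Bool n → Set
MinimalTrue f x = f x ≡ true × (∀ y → y ⪯ x → ¬ x ≡ y → f y ≡ false)

Extremal : ∀ {n} → BF n → Vec Bool n → Set
Extremal f x = Data.Sum._⊎_ (MaximalFalse f x) (MinimalTrue f x) where import Data.Sum

{-# OPTIONS --safe #-}
-- Write E(f) for the number of extremal points of a positive function f and k(f) for its number of
-- relevant variables. Splitting f along x₀ into its cofactors h ≤ g, the extremal points of f are those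
-- of h together with the N(h, g) extremal points of g that are not extremal of the same kind for h.
-- The key inequality is  [h ≠ g] + #{variables relevant for g but not for h} ≤ N(h, g)  for positive
-- h ≤ g (and, by duality, for g ≤ h); it is proved by induction, splitting along a variable that is
-- relevant for g only. Since k(f) ≤ [h ≠ g] + k(h) + #{variables relevant for g only}, induction on the
-- number of variables gives E(f) ≥ k(f) + 1 for every positive f, and E(f) ≥ k(f) + 2 for non-split f
-- as long as h is non-split. Otherwise f vanishes on a quadrant x₀ = xᵢ = 0, and comparing the three
-- other quadrants, gluing two of them into a function of fewer variables when they coincide, yields
-- the missing extremal point. Whether x is extremal for a positive function only depends on f at x and
-- at the neighbours of x, so every pointwise comparison is a finite Boolean check.
module Submission where

open import Defs
open import Data.Bool using (Bool; true; false; not; _∧_; _∨_; _xor_; T) renaming (_≟_ to _≟ᵇ_)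
open import Data.Bool.Properties
  using ( not-involutive; not-injective; ∧-conicalˡ; ∧-conicalʳ; ∨-conicalˡ; ∨-conicalʳ; ∨-comm; ∧-idem
        ; xor-same; xor-comm; xor-annihilates-not; T-∧; ∨-commutativeMonoid; ∧-commutativeMonoid )
open import Data.Nat using (ℕ; zero; suc; _+_; _≤_; _≤ᵇ_; z≤n; s≤s)
open import Data.Nat.Properties
open import Data.Nat.Solver using (module +-*-Solver)
open +-*-Solver using (solve; _:=_; _:+_; con)
open import Data.Fin using (Fin; zero; suc; punchIn)
open import Data.Fin.Properties using (any?)
open import Data.Fin.Subset using (Subset; _∈_; ∣_∣; _∪_; _─_) renaming (⊥ to ∅)
open import Data.Fin.Subset.Properties
  using ( p─⊥≡p; p─q─r≡p─q∪r; ∣p─q∣≤∣p∣; ∣⊥∣≡0; ∪-comm; ∪-idem; ∪-identityˡ; ∪-commutativeMonoid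
        ; nonempty?; Empty-unique )
open import Data.Vec using (Vec; []; _∷_; lookup; insertAt; removeAt; map; replicate; zipWith)
open import Data.Vec.Properties
  using ( ≡-dec; tabulate∘lookup; tabulate-cong; lookup-replicate; []=⇒lookup; lookup⇒[]=
        ; insertAt-lookup; insertAt-punchIn; insertAt-removeAt )
open import Data.Vec.N-ary using (N-ary; _$ⁿ_)
open import Data.List using (List; []; _∷_; length)
import Data.List.Membership.Propositional as LM
open import Data.List.Relation.Unary.Any using (here; there)
open import Data.List.Relation.Unary.Unique.Propositional using (Unique)
open import Data.Product using (∃; _×_; _,_; proj₁; proj₂)
open import Data.Sum using (_⊎_; inj₁; inj₂)
open import Data.Unit using (tt)
open import Data.Empty using (⊥-elim)
open import Function using (_∘_)
open import Function.Bundles using (Equivalence; _⇔_)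
open import Relation.Binary.Definitions using (DecidableEquality)
open import Relation.Binary.PropositionalEquality
open import Relation.Nullary using (¬_; Dec; yes; no; does; contradiction)
open import Relation.Nullary.Decidable using (dec-true)
import Algebra.Bundles as Bundles
import Algebra.Properties.CommutativeSemigroup as CommutativeSemigroupProperties
open CommutativeSemigroupProperties +-commutativeSemigroup
  using () renaming (interchange to +-interchange; x∙yz≈y∙xz to +-left-swap)
open CommutativeSemigroupProperties (Bundles.CommutativeMonoid.commutativeSemigroup ∨-commutativeMonoid)
  using () renaming (interchange to ∨-interchange)
open CommutativeSemigroupProperties (Bundles.CommutativeMonoid.commutativeSemigroup ∧-commutativeMonoid)
  using () renaming (x∙yz≈y∙xz to ∧-left-swap)

toℕ : Bool → ℕ
toℕ false = 0
toℕ true  = 1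

toℕ≤1 : ∀ b → toℕ b ≤ 1
toℕ≤1 false = z≤n
toℕ≤1 true  = ≤-refl

not-true : ∀ {a} → not a ≡ true → a ≡ false
not-true {false} _ = refl

∪-left-swap : ∀ {n} (p q r : Subset n) → p ∪ (q ∪ r) ≡ q ∪ (p ∪ r)
∪-left-swap {n} = x∙yz≈y∙xz
  where
  open CommutativeSemigroupProperties (Bundles.CommutativeMonoid.commutativeSemigroup (∪-commutativeMonoid n))

∪-interchange : ∀ {n} (a b c d : Subset n) → (a ∪ b) ∪ (c ∪ d) ≡ (a ∪ c) ∪ (b ∪ d)
∪-interchange {n} = interchange
  where
  open CommutativeSemigroupProperties (Bundles.CommutativeMonoid.commutativeSemigroup (∪-commutativeMonoid n))

zipWith-insertAt : ∀ {n} (_•_ : Bool → Bool → Bool) (u v : Vec Bool n) w a b →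
  zipWith _•_ (insertAt u w a) (insertAt v w b) ≡ insertAt (zipWith _•_ u v) w (a • b)
zipWith-insertAt _•_ u       v       zero    a b = refl
zipWith-insertAt _•_ (c ∷ u) (d ∷ v) (suc w) a b = cong ((c • d) ∷_) (zipWith-insertAt _•_ u v w a b)

∣∷∣ : ∀ {n} b (p : Subset n) → ∣ b ∷ p ∣ ≡ toℕ b + ∣ p ∣
∣∷∣ false p = refl
∣∷∣ true  p = refl

∣x∷p∣≤1+∣p∣ : ∀ {n} b (p : Subset n) → ∣ b ∷ p ∣ ≤ 1 + ∣ p ∣
∣x∷p∣≤1+∣p∣ b p = ≤-trans (≤-reflexive (∣∷∣ b p)) (+-monoˡ-≤ ∣ p ∣ (toℕ≤1 b))

∣insertAt∣ : ∀ {n} (p : Subset n) w b → ∣ insertAt p w b ∣ ≡ toℕ b + ∣ p ∣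
∣insertAt∣ p           zero    false = refl
∣insertAt∣ p           zero    true  = refl
∣insertAt∣ (false ∷ p) (suc w) b     = ∣insertAt∣ p w b
∣insertAt∣ (true ∷ p)  (suc w) b     = trans (cong suc (∣insertAt∣ p w b)) (sym (+-suc (toℕ b) ∣ p ∣))

∣insertAt─insertAt∣ : ∀ {n} (p q : Subset n) w a b → ∣ insertAt p w a ─ insertAt q w b ∣ ≡ ∣ (a ∷ p) ─ (b ∷ q) ∣
∣insertAt─insertAt∣ p           q          zero    a b = refl
∣insertAt─insertAt∣ (_ ∷ p)     (true ∷ q)  (suc w) a b = ∣insertAt─insertAt∣ p q w a b
∣insertAt─insertAt∣ (false ∷ p) (false ∷ q) (suc w) a b = ∣insertAt─insertAt∣ p q w a b
∣insertAt─insertAt∣ (true ∷ p)  (false ∷ q) (suc w) a b =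
  trans (cong suc (∣insertAt─insertAt∣ p q w a b)) (swap a b)
  where
  swap : ∀ a b → suc ∣ (a ∷ p) ─ (b ∷ q) ∣ ≡ ∣ (a ∷ true ∷ p) ─ (b ∷ false ∷ q) ∣
  swap a     true  = refl
  swap false false = refl
  swap true  false = refl

∣x∷p─y∷q∣≤1+∣p─q∣ : ∀ {n} a b (p q : Subset n) → ∣ (a ∷ p) ─ (b ∷ q) ∣ ≤ 1 + ∣ p ─ q ∣
∣x∷p─y∷q∣≤1+∣p─q∣ a     true  p q = n≤1+n _
∣x∷p─y∷q∣≤1+∣p─q∣ false false p q = n≤1+n _
∣x∷p─y∷q∣≤1+∣p─q∣ true  false p q = ≤-refl

∣p─p∣≡0 : ∀ {n} (p : Subset n) → ∣ p ─ p ∣ ≡ 0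
∣p─p∣≡0 []          = refl
∣p─p∣≡0 (false ∷ p) = ∣p─p∣≡0 p
∣p─p∣≡0 (true ∷ p)  = ∣p─p∣≡0 p

lookup-─ : ∀ {n} (p q : Subset n) w → lookup (p ─ q) w ≡ true → lookup p w ≡ true × lookup q w ≡ false
lookup-─ (a ∷ p) (false ∷ q) zero    a≡1 = a≡1 , refl
lookup-─ (a ∷ p) (b ∷ q)     (suc w) p─qʷ = lookup-─ p q w p─qʷ

∣p─q∪r∣≤∣p─q∣ : ∀ {n} (p q r : Subset n) → ∣ p ─ (q ∪ r) ∣ ≤ ∣ p ─ q ∣
∣p─q∪r∣≤∣p─q∣ p q r = subst (λ s → ∣ s ∣ ≤ ∣ p ─ q ∣) (p─q─r≡p─q∪r p q r) (∣p─q∣≤∣p∣ (p ─ q) r)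

∣p∪q─r∣≤∣p─r∣+∣q─p∣ : ∀ {n} (p q r : Subset n) → ∣ p ∪ q ─ r ∣ ≤ ∣ p ─ r ∣ + ∣ q ─ p ∣
∣p∪q─r∣≤∣p─r∣+∣q─p∣ []          []          []          = z≤n
∣p∪q─r∣≤∣p─r∣+∣q─p∣ (true ∷ p)  (_ ∷ q)     (true ∷ r)  = ∣p∪q─r∣≤∣p─r∣+∣q─p∣ p q r
∣p∪q─r∣≤∣p─r∣+∣q─p∣ (false ∷ p) (false ∷ q) (true ∷ r)  = ∣p∪q─r∣≤∣p─r∣+∣q─p∣ p q r
∣p∪q─r∣≤∣p─r∣+∣q─p∣ (false ∷ p) (true ∷ q)  (true ∷ r)  =
  ≤-trans (∣p∪q─r∣≤∣p─r∣+∣q─p∣ p q r) (+-monoʳ-≤ ∣ p ─ r ∣ (n≤1+n ∣ q ─ p ∣))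
∣p∪q─r∣≤∣p─r∣+∣q─p∣ (true ∷ p)  (_ ∷ q)     (false ∷ r) = s≤s (∣p∪q─r∣≤∣p─r∣+∣q─p∣ p q r)
∣p∪q─r∣≤∣p─r∣+∣q─p∣ (false ∷ p) (false ∷ q) (false ∷ r) = ∣p∪q─r∣≤∣p─r∣+∣q─p∣ p q r
∣p∪q─r∣≤∣p─r∣+∣q─p∣ (false ∷ p) (true ∷ q)  (false ∷ r) =
  ≤-trans (s≤s (∣p∪q─r∣≤∣p─r∣+∣q─p∣ p q r)) (≤-reflexive (sym (+-suc ∣ p ─ r ∣ ∣ q ─ p ∣)))

∣p∪q∣≤∣p∣+∣q─p∣ : ∀ {n} (p q : Subset n) → ∣ p ∪ q ∣ ≤ ∣ p ∣ + ∣ q ─ p ∣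
∣p∪q∣≤∣p∣+∣q─p∣ p q =
  subst₂ (λ s t → ∣ s ∣ ≤ ∣ t ∣ + ∣ q ─ p ∣) (p─⊥≡p (p ∪ q)) (p─⊥≡p p) (∣p∪q─r∣≤∣p─r∣+∣q─p∣ p q ∅)

∣p∪q∪r∣≤∣p∣+∣r─p∣+∣q─r∣ : ∀ {n} (p q r : Subset n) → ∣ p ∪ (q ∪ r) ∣ ≤ ∣ p ∣ + (∣ r ─ p ∣ + ∣ q ─ r ∣)
∣p∪q∪r∣≤∣p∣+∣r─p∣+∣q─r∣ p q r = begin
  ∣ p ∪ (q ∪ r) ∣                 ≤⟨ ∣p∪q∣≤∣p∣+∣q─p∣ p (q ∪ r) ⟩
  ∣ p ∣ + ∣ q ∪ r ─ p ∣           ≡⟨ cong (λ s → ∣ p ∣ + ∣ s ─ p ∣) (∪-comm q r) ⟩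
  ∣ p ∣ + ∣ r ∪ q ─ p ∣           ≤⟨ +-monoʳ-≤ ∣ p ∣ (∣p∪q─r∣≤∣p─r∣+∣q─p∣ r q p) ⟩
  ∣ p ∣ + (∣ r ─ p ∣ + ∣ q ─ r ∣) ∎
  where open ≤-Reasoning

sumCube : ∀ {n} → (Vec Bool n → ℕ) → ℕ
sumCube {zero}  φ = φ []
sumCube {suc n} φ = sumCube (φ ∘ (false ∷_)) + sumCube (φ ∘ (true ∷_))

sumCube-cong : ∀ {n} {φ ψ : Vec Bool n → ℕ} → φ ≗ ψ → sumCube φ ≡ sumCube ψ
sumCube-cong {zero}  φ≗ψ = φ≗ψ []
sumCube-cong {suc n} φ≗ψ = cong₂ _+_ (sumCube-cong (φ≗ψ ∘ (false ∷_))) (sumCube-cong (φ≗ψ ∘ (true ∷_)))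

sumCube-mono-≤ : ∀ {n} {φ ψ : Vec Bool n → ℕ} → (∀ x → φ x ≤ ψ x) → sumCube φ ≤ sumCube ψ
sumCube-mono-≤ {zero}  φ≤ψ = φ≤ψ []
sumCube-mono-≤ {suc n} φ≤ψ = +-mono-≤ (sumCube-mono-≤ (φ≤ψ ∘ (false ∷_))) (sumCube-mono-≤ (φ≤ψ ∘ (true ∷_)))

sumCube-distrib-+ : ∀ {n} (φ ψ : Vec Bool n → ℕ) → sumCube (λ x → φ x + ψ x) ≡ sumCube φ + sumCube ψ
sumCube-distrib-+ {zero}  φ ψ = refl
sumCube-distrib-+ {suc n} φ ψ = trans
  (cong₂ _+_ (sumCube-distrib-+ (φ ∘ (false ∷_)) (ψ ∘ (false ∷_)))
             (sumCube-distrib-+ (φ ∘ (true ∷_)) (ψ ∘ (true ∷_))))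
  (+-interchange (sumCube (φ ∘ (false ∷_))) _ _ _)

sumCube-zero : ∀ n → sumCube {n} (λ _ → 0) ≡ 0
sumCube-zero zero    = refl
sumCube-zero (suc n) = cong₂ _+_ (sumCube-zero n) (sumCube-zero n)

point≤sumCube : ∀ {n} (φ : Vec Bool n → ℕ) x → φ x ≤ sumCube φ
point≤sumCube φ []          = ≤-refl
point≤sumCube φ (false ∷ x) = ≤-trans (point≤sumCube (φ ∘ (false ∷_)) x) (m≤m+n _ _)
point≤sumCube φ (true ∷ x)  = ≤-trans (point≤sumCube (φ ∘ (true ∷_)) x) (m≤n+m _ _)

twoPoints≤sumCube : ∀ {n} (φ : Vec Bool n → ℕ) {x y} → x ≢ y → φ x + φ y ≤ sumCube φ
twoPoints≤sumCube φ {[]}        {[]}        x≢y = ⊥-elim (x≢y refl)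
twoPoints≤sumCube φ {false ∷ x} {false ∷ y} x≢y =
  ≤-trans (twoPoints≤sumCube (φ ∘ (false ∷_)) (x≢y ∘ cong (false ∷_))) (m≤m+n _ _)
twoPoints≤sumCube φ {true ∷ x}  {true ∷ y}  x≢y =
  ≤-trans (twoPoints≤sumCube (φ ∘ (true ∷_)) (x≢y ∘ cong (true ∷_))) (m≤n+m _ _)
twoPoints≤sumCube φ {false ∷ x} {true ∷ y}  _ =
  +-mono-≤ (point≤sumCube (φ ∘ (false ∷_)) x) (point≤sumCube (φ ∘ (true ∷_)) y)
twoPoints≤sumCube φ {true ∷ x}  {false ∷ y} _ = subst (_≤ sumCube φ) (+-comm (φ (false ∷ y)) _)
  (+-mono-≤ (point≤sumCube (φ ∘ (false ∷_)) y) (point≤sumCube (φ ∘ (true ∷_)) x))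

sumCube-insertAt : ∀ {n} (φ : Vec Bool (suc n) → ℕ) w →
  sumCube φ ≡ sumCube (λ x → φ (insertAt x w false)) + sumCube (λ x → φ (insertAt x w true))
sumCube-insertAt         φ zero    = refl
sumCube-insertAt {suc n} φ (suc w) = trans
  (cong₂ _+_ (sumCube-insertAt (φ ∘ (false ∷_)) w) (sumCube-insertAt (φ ∘ (true ∷_)) w))
  (+-interchange (sumCube (λ x → φ (false ∷ insertAt x w false))) _ _ _)

sumCube-map-not : ∀ {n} (φ : Vec Bool n → ℕ) → sumCube φ ≡ sumCube (φ ∘ map not)
sumCube-map-not {zero}  φ = refl
sumCube-map-not {suc n} φ = trans
  (cong₂ _+_ (sumCube-map-not (φ ∘ (false ∷_))) (sumCube-map-not (φ ∘ (true ∷_))))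
  (+-comm (sumCube (λ x → φ (false ∷ map not x))) _)

sumCube-+-mono-≤ : ∀ {n} {φ ψ χ ω : Vec Bool n → ℕ} → (∀ x → φ x + ψ x ≤ χ x + ω x) →
  sumCube φ + sumCube ψ ≤ sumCube χ + sumCube ω
sumCube-+-mono-≤ {φ = φ} {ψ} {χ} {ω} pointwise = begin
  sumCube φ + sumCube ψ         ≡⟨ sym (sumCube-distrib-+ φ ψ) ⟩
  sumCube (λ x → φ x + ψ x)     ≤⟨ sumCube-mono-≤ pointwise ⟩
  sumCube (λ x → χ x + ω x)     ≡⟨ sumCube-distrib-+ χ ω ⟩
  sumCube χ + sumCube ω         ∎
  where open ≤-Reasoning

sumCube-+-≤ : ∀ {n} {φ ψ χ : Vec Bool n → ℕ} → (∀ x → φ x + ψ x ≤ χ x) → sumCube φ + sumCube ψ ≤ sumCube χ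
sumCube-+-≤ {φ = φ} {ψ} pointwise =
  ≤-trans (≤-reflexive (sym (sumCube-distrib-+ φ ψ))) (sumCube-mono-≤ pointwise)

anyPoint : ∀ {n} → (Vec Bool n → Bool) → Bool
anyPoint {zero}  p = p []
anyPoint {suc n} p = anyPoint (p ∘ (false ∷_)) ∨ anyPoint (p ∘ (true ∷_))

anyPoint-sound : ∀ {n} (p : Vec Bool n → Bool) → anyPoint p ≡ true → ∃ λ x → p x ≡ true
anyPoint-sound {zero}  p any = [] , any
anyPoint-sound {suc n} p any with anyPoint (p ∘ (false ∷_)) in any₀
... | true  = let x , px = anyPoint-sound (p ∘ (false ∷_)) any₀ in false ∷ x , px
... | false = let x , px = anyPoint-sound (p ∘ (true ∷_)) any in true ∷ x , px

anyPoint-false : ∀ {n} (p : Vec Bool n → Bool) → anyPoint p ≡ false → ∀ x → p x ≡ false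
anyPoint-false p none []          = none
anyPoint-false p none (false ∷ x) = anyPoint-false (p ∘ (false ∷_)) (∨-conicalˡ _ _ none) x
anyPoint-false p none (true ∷ x)  = anyPoint-false (p ∘ (true ∷_)) (∨-conicalʳ _ _ none) x

anyPoint-none : ∀ {n} {p : Vec Bool n → Bool} → (∀ x → p x ≡ false) → anyPoint p ≡ false
anyPoint-none {zero}  none = none []
anyPoint-none {suc n} none = cong₂ _∨_ (anyPoint-none (none ∘ (false ∷_))) (anyPoint-none (none ∘ (true ∷_)))

anyPoint-cong : ∀ {n} {p q : Vec Bool n → Bool} → p ≗ q → anyPoint p ≡ anyPoint q
anyPoint-cong {zero}  p≗q = p≗q []
anyPoint-cong {suc n} p≗q = cong₂ _∨_ (anyPoint-cong (p≗q ∘ (false ∷_))) (anyPoint-cong (p≗q ∘ (true ∷_)))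

anyPoint-insertAt : ∀ {n} (p : Vec Bool (suc n) → Bool) w →
  anyPoint p ≡ anyPoint (λ x → p (insertAt x w false)) ∨ anyPoint (λ x → p (insertAt x w true))
anyPoint-insertAt         p zero    = refl
anyPoint-insertAt {suc n} p (suc w) = trans
  (cong₂ _∨_ (anyPoint-insertAt (p ∘ (false ∷_)) w) (anyPoint-insertAt (p ∘ (true ∷_)) w))
  (∨-interchange (anyPoint (λ x → p (false ∷ insertAt x w false))) _ _ _)

anyPoint-map-not : ∀ {n} (p : Vec Bool n → Bool) → anyPoint p ≡ anyPoint (p ∘ map not)
anyPoint-map-not {zero}  p = refl
anyPoint-map-not {suc n} p = trans
  (cong₂ _∨_ (anyPoint-map-not (p ∘ (false ∷_))) (anyPoint-map-not (p ∘ (true ∷_))))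
  (∨-comm (anyPoint (λ x → p (false ∷ map not x))) _)

-- Positive functions and cofactors

cof₀ cof₁ : ∀ {n} → BF (suc n) → BF n
cof₀ f x = f (false ∷ x)
cof₁ f x = f (true ∷ x)

infix 4 _≤ᶠ_
_≤ᶠ_ : ∀ {n} → BF n → BF n → Set
h ≤ᶠ g = ∀ x → h x ≡ true → g x ≡ true

≗⇒≤ᶠ : ∀ {n} {u v : BF n} → u ≗ v → u ≤ᶠ v
≗⇒≤ᶠ u≗v x ux = trans (sym (u≗v x)) ux

≤ᶠ-false : ∀ {n} {h g : BF n} → h ≤ᶠ g → ∀ x → g x ≡ false → h x ≡ false
≤ᶠ-false {h = h} h≤g x gx with h x in hx
... | false = refl
... | true  = trans (sym (h≤g x hx)) gx

⪯-refl : ∀ {n} {x : Vec Bool n} → x ⪯ x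
⪯-refl j x≡1 = x≡1

⪯-∷ : ∀ {n} {a b} {x y : Vec Bool n} → (a ≡ true → b ≡ true) → x ⪯ y → (a ∷ x) ⪯ (b ∷ y)
⪯-∷ a⇒b x⪯y zero    = a⇒b
⪯-∷ a⇒b x⪯y (suc j) = x⪯y j

insertAt-mono-⪯ : ∀ {n} {x y : Vec Bool n} w b → x ⪯ y → insertAt x w b ⪯ insertAt y w b
insertAt-mono-⪯             zero    b x⪯y = ⪯-∷ (λ b≡1 → b≡1) x⪯y
insertAt-mono-⪯ {x = _ ∷ _} {_ ∷ _} (suc w) b x⪯y = ⪯-∷ (x⪯y zero) (insertAt-mono-⪯ w b (x⪯y ∘ suc))

insertAt-⪯-true : ∀ {n} (x : Vec Bool n) w b → insertAt x w b ⪯ insertAt x w true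
insertAt-⪯-true x       zero    b = ⪯-∷ (λ _ → refl) (⪯-refl {x = x})
insertAt-⪯-true (a ∷ x) (suc w) b = ⪯-∷ (λ a≡1 → a≡1) (insertAt-⪯-true x w b)

∅⪯ : ∀ {n} (x : Vec Bool n) → ∅ ⪯ x
∅⪯ {n} x j ∅ⱼ≡1 = contradiction (trans (sym (lookup-replicate j false)) ∅ⱼ≡1) λ ()

⪯𝟙 : ∀ {n} (x : Vec Bool n) → x ⪯ replicate n true
⪯𝟙 {n} x j _ = lookup-replicate j true

insertAt-∅ : ∀ {n} (v : Fin (suc n)) → insertAt ∅ v false ≡ ∅
insertAt-∅         zero    = refl
insertAt-∅ {suc n} (suc v) = cong (false ∷_) (insertAt-∅ v)

Positive-false : ∀ {n} {f : BF n} → Positive f → ∀ {x y} → x ⪯ y → f y ≡ false → f x ≡ false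
Positive-false {f = f} pos {x} {y} x⪯y fy with f x in fx
... | false = refl
... | true  = trans (sym (pos x y fx x⪯y)) fy

module _ {n} {f : BF (suc n)} (pos : Positive f) where

  Positive-cof₀ : Positive (cof₀ f)
  Positive-cof₀ x y fx x⪯y = pos (false ∷ x) (false ∷ y) fx (⪯-∷ (λ ()) x⪯y)

  Positive-cof₁ : Positive (cof₁ f)
  Positive-cof₁ x y fx x⪯y = pos (true ∷ x) (true ∷ y) fx (⪯-∷ (λ _ → refl) x⪯y)

  cof₀≤ᶠcof₁ : cof₀ f ≤ᶠ cof₁ f
  cof₀≤ᶠcof₁ x fx = pos (false ∷ x) (true ∷ x) fx (⪯-∷ (λ ()) (⪯-refl {x = x}))

  Positive-restrict : ∀ w b → Positive (restrict f w b)
  Positive-restrict w b x y fx x⪯y = pos _ _ fx (insertAt-mono-⪯ w b x⪯y)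

  restrict-≤ᶠ : ∀ w → restrict f w false ≤ᶠ restrict f w true
  restrict-≤ᶠ w x fx = pos _ _ fx (insertAt-⪯-true x w false)

glue : ∀ {n} → BF n → BF n → BF (suc n)
glue u v (false ∷ x) = u x
glue u v (true ∷ x)  = v x

toFront : ∀ {n} → Fin (suc n) → BF (suc n) → BF (suc n)
toFront w f = glue (restrict f w false) (restrict f w true)

Positive-glue : ∀ {n} {u v : BF n} → Positive u → Positive v → u ≤ᶠ v → Positive (glue u v)
Positive-glue pu pv u≤v (false ∷ x) (false ∷ y) ux x⪯y = pu x y ux (x⪯y ∘ suc)
Positive-glue pu pv u≤v (false ∷ x) (true ∷ y)  ux x⪯y = pv x y (u≤v x ux) (x⪯y ∘ suc)
Positive-glue pu pv u≤v (true ∷ x)  (true ∷ y)  vx x⪯y = pv x y vx (x⪯y ∘ suc)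
Positive-glue pu pv u≤v (true ∷ x)  (false ∷ y) vx x⪯y = contradiction (x⪯y zero refl) λ ()

nonzero-witness : ∀ {n} (p : BF n) → ¬ ≡0 p → ∃ λ x → p x ≡ true
nonzero-witness p p≢0 with anyPoint p in any
... | true  = anyPoint-sound p any
... | false = ⊥-elim (p≢0 (anyPoint-false p any))

nonone-witness : ∀ {n} (p : BF n) → ¬ ≡1 p → ∃ λ x → p x ≡ false
nonone-witness p p≢1 with nonzero-witness (not ∘ p) (λ p≡1 → p≢1 (λ x → not-injective (p≡1 x)))
... | x , px = x , not-true px

≡0? : ∀ {n} (p : BF n) → Dec (≡0 p)
≡0? p with anyPoint p in any
... | true  = let x , px = anyPoint-sound p any in no (λ p≡0 → contradiction (trans (sym px) (p≡0 x)) λ ())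
... | false = yes (anyPoint-false p any)

bottom-false : ∀ {n} {p : BF n} → Positive p → ¬ ≡1 p → p ∅ ≡ false
bottom-false {p = p} pos p≢1 with nonone-witness p p≢1
... | y , py = Positive-false pos (∅⪯ y) py

top-true : ∀ {n} {p : BF n} → Positive p → ¬ ≡0 p → p (replicate n true) ≡ true
top-true {p = p} pos p≢0 with nonzero-witness p p≢0
... | y , py = pos y _ py (⪯𝟙 y)

restrict-lookup : ∀ {n} (f : BF (suc n)) w y → restrict f w (lookup y w) (removeAt y w) ≡ f y
restrict-lookup f w y = cong f (insertAt-removeAt y w)

restrictions-≡0 : ∀ {n} {f : BF (suc n)} w → ≡0 (restrict f w false) → ≡0 (restrict f w true) → ≡0 f
restrictions-≡0 {f = f} w f₀≡0 f₁≡0 y = trans (sym (restrict-lookup f w y)) (restriction-≡0 (lookup y w))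
  where
  restriction-≡0 : ∀ b → restrict f w b (removeAt y w) ≡ false
  restriction-≡0 false = f₀≡0 (removeAt y w)
  restriction-≡0 true  = f₁≡0 (removeAt y w)

restrictions-≡1 : ∀ {n} {f : BF (suc n)} w → ≡1 (restrict f w false) → ≡1 (restrict f w true) → ≡1 f
restrictions-≡1 {f = f} w f₀≡1 f₁≡1 y = trans (sym (restrict-lookup f w y)) (restriction-≡1 (lookup y w))
  where
  restriction-≡1 : ∀ b → restrict f w b (removeAt y w) ≡ true
  restriction-≡1 false = f₀≡1 (removeAt y w)
  restriction-≡1 true  = f₁≡1 (removeAt y w)

restrict-cof₁-nonzero : ∀ {n} {f : BF (suc (suc n))} → Positive f → ∀ j →
  ¬ ≡0 (restrict f (suc j) false) → ¬ ≡0 (restrict (cof₁ f) j false)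
restrict-cof₁-nonzero pos j f≢0 g≡0 = f≢0 λ
  { (false ∷ x) → ≤ᶠ-false (cof₀≤ᶠcof₁ pos) (insertAt x j false) (g≡0 x)
  ; (true ∷ x)  → g≡0 x }

restrict-cof₀-nonone : ∀ {n} {f : BF (suc (suc n))} → Positive f → ∀ j →
  ¬ ≡1 (restrict f (suc j) true) → ¬ ≡1 (restrict (cof₀ f) j true)
restrict-cof₀-nonone pos j f≢1 h≡1 = f≢1 λ
  { (false ∷ x) → h≡1 x
  ; (true ∷ x)  → cof₀≤ᶠcof₁ pos (insertAt x j true) (h≡1 x) }

Avoidable : ∀ {n} → BF n → Fin n → Set
Avoidable p v = ∃ λ y → lookup y v ≡ false × p y ≡ true

avoidable-restrict : ∀ {n} {g : BF (suc n)} → Positive g → ∀ i v →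
  ¬ ≡0 (restrict g (punchIn i v) false) → Avoidable (restrict g i true) v
avoidable-restrict {g = g} pos i v g≢0 with nonzero-witness _ g≢0
... | x , gx = y , y-avoids , pos _ _ (trans (restrict-lookup g i z) gx) (insertAt-⪯-true y i (lookup z i))
  where
  z = insertAt x (punchIn i v) false
  y = removeAt z i
  y-avoids : lookup y v ≡ false
  y-avoids = trans (sym (insertAt-punchIn y i (lookup z i) v))
    (trans (cong (λ t → lookup t (punchIn i v)) (insertAt-removeAt z i))
           (insertAt-lookup x (punchIn i v) false))

-- Relevant variables

differ : ∀ {n} → BF n → BF n → Bool
differ h g = anyPoint (λ x → h x xor g x)

differ-false : ∀ {n} {h g : BF n} → differ h g ≡ false → h ≗ g
differ-false {h = h} {g} same x = xor-false (h x) (g x) (anyPoint-false _ same x)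
  where
  xor-false : ∀ a b → a xor b ≡ false → a ≡ b
  xor-false false false _ = refl
  xor-false true  true  _ = refl

differ-true : ∀ {n} {h g : BF n} → h ≤ᶠ g → differ h g ≡ true → ∃ λ x → h x ≡ false × g x ≡ true
differ-true {h = h} {g} h≤g differ≡1 with anyPoint-sound _ differ≡1
... | x , h⊕g with h x in hx | g x in gx
... | false | true  = x , hx , gx
... | true  | true  = contradiction h⊕g λ ()
... | true  | false = contradiction (trans (sym (h≤g x hx)) gx) λ ()

differ-cong : ∀ {n} {h h′ g g′ : BF n} → h ≗ h′ → g ≗ g′ → differ h g ≡ differ h′ g′
differ-cong h≗h′ g≗g′ = anyPoint-cong (λ x → cong₂ _xor_ (h≗h′ x) (g≗g′ x))

differ-comm : ∀ {n} (h g : BF n) → differ h g ≡ differ g h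
differ-comm h g = anyPoint-cong λ x → xor-comm (h x) (g x)

differ-toFront : ∀ {n} (h g : BF (suc n)) w → differ (toFront w h) (toFront w g) ≡ differ h g
differ-toFront h g w = sym (anyPoint-insertAt (λ y → h y xor g y) w)

relevant : ∀ {n} → BF n → Subset n
relevant {zero}  f = []
relevant {suc n} f = differ (cof₀ f) (cof₁ f) ∷ (relevant (cof₀ f) ∪ relevant (cof₁ f))

relevant-cong : ∀ {n} {f g : BF n} → f ≗ g → relevant f ≡ relevant g
relevant-cong {zero}  f≗g = refl
relevant-cong {suc n} f≗g = cong₂ _∷_
  (differ-cong (f≗g ∘ (false ∷_)) (f≗g ∘ (true ∷_)))
  (cong₂ _∪_ (relevant-cong (f≗g ∘ (false ∷_))) (relevant-cong (f≗g ∘ (true ∷_))))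

relevant-insertAt : ∀ {n} (f : BF (suc n)) w →
  relevant f ≡ insertAt (relevant (restrict f w false) ∪ relevant (restrict f w true)) w
                        (differ (restrict f w false) (restrict f w true))
relevant-insertAt         f zero    = refl
relevant-insertAt {suc n} f (suc w) = begin
  differ (cof₀ f) (cof₁ f) ∷ (relevant (cof₀ f) ∪ relevant (cof₁ f))
    ≡⟨ cong₂ (λ r₀ r₁ → differ (cof₀ f) (cof₁ f) ∷ (r₀ ∪ r₁))
             (relevant-insertAt (cof₀ f) w) (relevant-insertAt (cof₁ f) w) ⟩
  differ (cof₀ f) (cof₁ f) ∷ (insertAt (r₀₀ ∪ r₀₁) w d₀ ∪ insertAt (r₁₀ ∪ r₁₁) w d₁)
    ≡⟨ cong₂ _∷_ (anyPoint-insertAt (λ x → f (false ∷ x) xor f (true ∷ x)) w)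
                 (zipWith-insertAt _∨_ (r₀₀ ∪ r₀₁) (r₁₀ ∪ r₁₁) w d₀ d₁) ⟩
  (e₀ ∨ e₁) ∷ insertAt ((r₀₀ ∪ r₀₁) ∪ (r₁₀ ∪ r₁₁)) w (d₀ ∨ d₁)
    ≡⟨ cong (λ r → (e₀ ∨ e₁) ∷ insertAt r w (d₀ ∨ d₁)) (∪-interchange r₀₀ r₀₁ r₁₀ r₁₁) ⟩
  (e₀ ∨ e₁) ∷ insertAt ((r₀₀ ∪ r₁₀) ∪ (r₀₁ ∪ r₁₁)) w (d₀ ∨ d₁) ∎
  where
  open ≡-Reasoning
  r₀₀ = relevant (restrict (cof₀ f) w false)
  r₀₁ = relevant (restrict (cof₀ f) w true)
  r₁₀ = relevant (restrict (cof₁ f) w false)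
  r₁₁ = relevant (restrict (cof₁ f) w true)
  d₀ = differ (restrict (cof₀ f) w false) (restrict (cof₀ f) w true)
  d₁ = differ (restrict (cof₁ f) w false) (restrict (cof₁ f) w true)
  e₀ = differ (cof₀ (restrict f (suc w) false)) (cof₁ (restrict f (suc w) false))
  e₁ = differ (cof₀ (restrict f (suc w) true)) (cof₁ (restrict f (suc w) true))

lookup-relevant : ∀ {n} (f : BF (suc n)) w →
  lookup (relevant f) w ≡ differ (restrict f w false) (restrict f w true)
lookup-relevant f w = trans (cong (λ r → lookup r w) (relevant-insertAt f w)) (insertAt-lookup _ w _)

relevant-≡0 : ∀ {n} {f : BF n} → ≡0 f → relevant f ≡ ∅
relevant-≡0 {zero}  f≡0 = refl
relevant-≡0 {suc n} f≡0 = cong₂ _∷_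
  (anyPoint-none λ x → cong₂ _xor_ (f≡0 (false ∷ x)) (f≡0 (true ∷ x)))
  (trans (cong₂ _∪_ (relevant-≡0 (f≡0 ∘ (false ∷_))) (relevant-≡0 (f≡0 ∘ (true ∷_)))) (∪-identityˡ ∅))

∣relevant-toFront∣ : ∀ {n} (f : BF (suc n)) w → ∣ relevant (toFront w f) ∣ ≡ ∣ relevant f ∣
∣relevant-toFront∣ f w = begin
  ∣ d ∷ r ∣          ≡⟨ ∣∷∣ d r ⟩
  toℕ d + ∣ r ∣      ≡⟨ sym (∣insertAt∣ r w d) ⟩
  ∣ insertAt r w d ∣ ≡⟨ cong ∣_∣ (sym (relevant-insertAt f w)) ⟩
  ∣ relevant f ∣     ∎
  where
  open ≡-Reasoning
  d = differ (restrict f w false) (restrict f w true)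
  r = relevant (restrict f w false) ∪ relevant (restrict f w true)

∣relevant-toFront─relevant-toFront∣ : ∀ {n} (h g : BF (suc n)) w →
  ∣ relevant (toFront w g) ─ relevant (toFront w h) ∣ ≡ ∣ relevant g ─ relevant h ∣
∣relevant-toFront─relevant-toFront∣ h g w = sym (trans
  (cong₂ (λ r s → ∣ r ─ s ∣) (relevant-insertAt g w) (relevant-insertAt h w))
  (∣insertAt─insertAt∣ _ _ w _ _))

∣relevant-glue∣ : ∀ {n} {u p : BF n} {b} → differ u p ≡ b →
  ∣ relevant (glue u p) ∣ ≡ toℕ b + ∣ relevant u ∪ relevant p ∣
∣relevant-glue∣ {u = u} {p} refl = ∣∷∣ (differ u p) (relevant u ∪ relevant p)

newRelevantCount : ∀ {n} → BF n → BF n → ℕ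
newRelevantCount h g = ∣ relevant g ─ relevant h ∣

∣relevant-glue─relevant-glue∣ : ∀ {n} (h₀ h₁ g₀ g₁ : BF n) →
  ∣ relevant (glue g₀ g₁) ─ relevant (glue h₀ h₁) ∣
    ≤ 1 + (∣ relevant g₀ ─ relevant h₀ ∣ + ∣ relevant g₁ ─ relevant g₀ ∣)
∣relevant-glue─relevant-glue∣ h₀ h₁ g₀ g₁ = ≤-trans
  (∣x∷p─y∷q∣≤1+∣p─q∣ (differ g₀ g₁) (differ h₀ h₁) (relevant g₀ ∪ relevant g₁) (relevant h₀ ∪ relevant h₁))
  (+-monoʳ-≤ 1 (≤-trans (∣p─q∪r∣≤∣p─q∣ (relevant g₀ ∪ relevant g₁) (relevant h₀) (relevant h₁))
                        (∣p∪q─r∣≤∣p─r∣+∣q─p∣ (relevant g₀) (relevant g₁) (relevant h₀))))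

∣relevant∣-cofactors : ∀ {n} (f : BF (suc n)) →
  ∣ relevant f ∣ ≤ toℕ (differ (cof₀ f) (cof₁ f)) + (∣ relevant (cof₀ f) ∣ + newRelevantCount (cof₀ f) (cof₁ f))
∣relevant∣-cofactors f = ≤-trans
  (≤-reflexive (∣∷∣ (differ (cof₀ f) (cof₁ f)) (relevant (cof₀ f) ∪ relevant (cof₁ f))))
  (+-monoʳ-≤ (toℕ (differ (cof₀ f) (cof₁ f))) (∣p∪q∣≤∣p∣+∣q─p∣ (relevant (cof₀ f)) (relevant (cof₁ f))))

differ-true⇒Relevant : ∀ {n} {f : BF (suc n)} j →
  differ (restrict f j false) (restrict f j true) ≡ true → Relevant f j
differ-true⇒Relevant {f = f} j f₀≢f₁ f₀≗f₁
  with anyPoint-sound (λ x → restrict f j false x xor restrict f j true x) f₀≢f₁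
... | x , f₀⊕f₁ = contradiction
  (trans (sym f₀⊕f₁) (trans (cong (_xor restrict f j true x) (f₀≗f₁ x)) (xor-same (restrict f j true x)))) λ ()

relevant-unique : ∀ {n} {f : BF (suc n)} (R : Subset (suc n)) → (∀ j → (j ∈ R) ⇔ Relevant f j) → R ≡ relevant f
relevant-unique {f = f} R R⇔Relevant =
  trans (sym (tabulate∘lookup R)) (trans (tabulate-cong same) (tabulate∘lookup (relevant f)))
  where
  same : ∀ j → lookup R j ≡ lookup (relevant f) j
  same j with lookup R j in Rⱼ | differ (restrict f j false) (restrict f j true) in f₀≢f₁
  ... | true  | true  = sym (trans (lookup-relevant f j) f₀≢f₁)
  ... | false | false = sym (trans (lookup-relevant f j) f₀≢f₁)
  ... | true  | false = contradiction (differ-false f₀≢f₁) (Equivalence.to (R⇔Relevant j) (lookup⇒[]= j R Rⱼ))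
  ... | false | true  = contradiction
    (trans (sym ([]=⇒lookup (Equivalence.from (R⇔Relevant j) (differ-true⇒Relevant {f = f} j f₀≢f₁)))) Rⱼ) λ ()

-- Extremal points

belowFalse : ∀ {n} → BF n → Vec Bool n → Bool
belowFalse f []          = true
belowFalse f (false ∷ x) = belowFalse (cof₀ f) x
belowFalse f (true ∷ x)  = not (f (false ∷ x)) ∧ belowFalse (cof₁ f) x

aboveTrue : ∀ {n} → BF n → Vec Bool n → Bool
aboveTrue f []          = true
aboveTrue f (true ∷ x)  = aboveTrue (cof₁ f) x
aboveTrue f (false ∷ x) = f (true ∷ x) ∧ aboveTrue (cof₀ f) x

-- For positive f, x is a minimal true point iff f x holds and f is false at every point obtained from x
-- by switching off one coordinate (dually for maximal false points): only these three bits matter.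
record Profile : Set where
  constructor ⟨_,_,_⟩
  field
    value below above : Bool
open Profile

profile : ∀ {n} → BF n → Vec Bool n → Profile
profile f x = ⟨ f x , belowFalse f x , aboveTrue f x ⟩

isMinTrue isMaxFalse : Profile → Bool
isMinTrue  π = value π ∧ below π
isMaxFalse π = not (value π) ∧ above π

minTrue maxFalse : ∀ {n} → BF n → Vec Bool n → Bool
minTrue  f = isMinTrue ∘ profile f
maxFalse f = isMaxFalse ∘ profile f

belowFalse-insertAt-false : ∀ {n} (f : BF (suc n)) w x →
  belowFalse f (insertAt x w false) ≡ belowFalse (restrict f w false) x
belowFalse-insertAt-false f zero    x           = refl
belowFalse-insertAt-false f (suc w) (false ∷ x) = belowFalse-insertAt-false (cof₀ f) w x
belowFalse-insertAt-false f (suc w) (true ∷ x)  =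
  cong (not (f (false ∷ insertAt x w false)) ∧_) (belowFalse-insertAt-false (cof₁ f) w x)

belowFalse-insertAt-true : ∀ {n} (f : BF (suc n)) w x →
  belowFalse f (insertAt x w true) ≡ not (restrict f w false x) ∧ belowFalse (restrict f w true) x
belowFalse-insertAt-true f zero    x           = refl
belowFalse-insertAt-true f (suc w) (false ∷ x) = belowFalse-insertAt-true (cof₀ f) w x
belowFalse-insertAt-true f (suc w) (true ∷ x)  = trans
  (cong (not (f (false ∷ insertAt x w true)) ∧_) (belowFalse-insertAt-true (cof₁ f) w x))
  (∧-left-swap (not (f (false ∷ insertAt x w true))) (not (f (true ∷ insertAt x w false))) _)

aboveTrue-insertAt-true : ∀ {n} (f : BF (suc n)) w x →
  aboveTrue f (insertAt x w true) ≡ aboveTrue (restrict f w true) x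
aboveTrue-insertAt-true f zero    x           = refl
aboveTrue-insertAt-true f (suc w) (true ∷ x)  = aboveTrue-insertAt-true (cof₁ f) w x
aboveTrue-insertAt-true f (suc w) (false ∷ x) =
  cong (f (true ∷ insertAt x w true) ∧_) (aboveTrue-insertAt-true (cof₀ f) w x)

aboveTrue-insertAt-false : ∀ {n} (f : BF (suc n)) w x →
  aboveTrue f (insertAt x w false) ≡ restrict f w true x ∧ aboveTrue (restrict f w false) x
aboveTrue-insertAt-false f zero    x           = refl
aboveTrue-insertAt-false f (suc w) (true ∷ x)  = aboveTrue-insertAt-false (cof₁ f) w x
aboveTrue-insertAt-false f (suc w) (false ∷ x) = trans
  (cong (f (true ∷ insertAt x w false) ∧_) (aboveTrue-insertAt-false (cof₀ f) w x))
  (∧-left-swap (f (true ∷ insertAt x w false)) (f (false ∷ insertAt x w true)) _)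

belowFalse-cong : ∀ {n} {f g : BF n} → f ≗ g → belowFalse f ≗ belowFalse g
belowFalse-cong f≗g []          = refl
belowFalse-cong f≗g (false ∷ x) = belowFalse-cong (f≗g ∘ (false ∷_)) x
belowFalse-cong f≗g (true ∷ x)  =
  cong₂ (λ a b → not a ∧ b) (f≗g (false ∷ x)) (belowFalse-cong (f≗g ∘ (true ∷_)) x)

minTrue-cong : ∀ {n} {f g : BF n} → f ≗ g → minTrue f ≗ minTrue g
minTrue-cong f≗g x = cong₂ _∧_ (f≗g x) (belowFalse-cong f≗g x)

belowFalse-anti : ∀ {n} {f g : BF n} → g ≤ᶠ f → ∀ x → belowFalse f x ≡ true → belowFalse g x ≡ true
belowFalse-anti g≤f []          _ = refl
belowFalse-anti g≤f (false ∷ x) b = belowFalse-anti (g≤f ∘ (false ∷_)) x b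
belowFalse-anti g≤f (true ∷ x)  b = cong₂ _∧_
  (cong not (≤ᶠ-false g≤f (false ∷ x) (not-true (∧-conicalˡ _ _ b))))
  (belowFalse-anti (g≤f ∘ (true ∷_)) x (∧-conicalʳ _ _ b))

aboveTrue-mono : ∀ {n} {f g : BF n} → f ≤ᶠ g → ∀ x → aboveTrue f x ≡ true → aboveTrue g x ≡ true
aboveTrue-mono f≤g []          _ = refl
aboveTrue-mono f≤g (true ∷ x)  a = aboveTrue-mono (f≤g ∘ (true ∷_)) x a
aboveTrue-mono f≤g (false ∷ x) a = cong₂ _∧_
  (f≤g (true ∷ x) (∧-conicalˡ _ _ a))
  (aboveTrue-mono (f≤g ∘ (false ∷_)) x (∧-conicalʳ _ _ a))

belowFalse-∅ : ∀ {n} (f : BF n) → belowFalse f ∅ ≡ true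
belowFalse-∅ {zero}  f = refl
belowFalse-∅ {suc n} f = belowFalse-∅ (cof₀ f)

aboveTrue-𝟙 : ∀ {n} (f : BF n) → aboveTrue f (replicate n true) ≡ true
aboveTrue-𝟙 {zero}  f = refl
aboveTrue-𝟙 {suc n} f = aboveTrue-𝟙 (cof₁ f)

aboveTrue-≡0 : ∀ {n} {f : BF n} → ≡0 f → ∀ x → aboveTrue f x ≡ true → x ≡ replicate n true
aboveTrue-≡0 f≡0 []          _  = refl
aboveTrue-≡0 f≡0 (true ∷ x)  up = cong (true ∷_) (aboveTrue-≡0 (f≡0 ∘ (true ∷_)) x up)
aboveTrue-≡0 f≡0 (false ∷ x) up = contradiction (trans (sym (∧-conicalˡ _ _ up)) (f≡0 (true ∷ x))) λ ()

minTrue-unit : ∀ {n} (f : BF (suc n)) v → f ∅ ≡ false → f (insertAt ∅ v true) ≡ true →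
  minTrue f (insertAt ∅ v true) ≡ true
minTrue-unit f v f∅ fe = cong₂ _∧_ fe (trans (belowFalse-insertAt-true f v ∅)
  (cong₂ _∧_ (cong not (trans (cong f (insertAt-∅ v)) f∅)) (belowFalse-∅ (restrict f v true))))

minTrue-below : ∀ {n} {g : BF n} → Positive g → ∀ x → g x ≡ true → ∃ λ a → a ⪯ x × minTrue g a ≡ true
minTrue-below         pos []          gx = [] , (λ ()) , cong₂ _∧_ gx refl
minTrue-below         pos (false ∷ x) gx with minTrue-below (Positive-cof₀ pos) x gx
... | a , a⪯x , min = false ∷ a , ⪯-∷ (λ ()) a⪯x , min
minTrue-below {g = g} pos (true ∷ x)  gx with g (false ∷ x) in g₀x
... | true  with minTrue-below (Positive-cof₀ pos) x g₀x
...   | a , a⪯x , min = false ∷ a , ⪯-∷ (λ _ → refl) a⪯x , min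
minTrue-below {g = g} pos (true ∷ x)  gx | false with minTrue-below (Positive-cof₁ pos) x gx
...   | a , a⪯x , min = true ∷ a , ⪯-∷ (λ 1≡1 → 1≡1) a⪯x ,
        cong₂ _∧_ (∧-conicalˡ (g (true ∷ a)) _ min)
                  (cong₂ _∧_ (cong not (Positive-false pos {false ∷ a} (⪯-∷ (λ ()) a⪯x) g₀x))
                             (∧-conicalʳ (g (true ∷ a)) _ min))

maxFalse-above : ∀ {n} {g : BF n} → Positive g → ∀ x → g x ≡ false → ∃ λ b → x ⪯ b × maxFalse g b ≡ true
maxFalse-above         pos []          gx = [] , (λ ()) , cong₂ _∧_ (cong not gx) refl
maxFalse-above         pos (true ∷ x)  gx with maxFalse-above (Positive-cof₁ pos) x gx
... | b , x⪯b , max = true ∷ b , ⪯-∷ (λ 1≡1 → 1≡1) x⪯b , max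
maxFalse-above {g = g} pos (false ∷ x) gx with g (true ∷ x) in g₁x
... | false with maxFalse-above (Positive-cof₁ pos) x g₁x
...   | b , x⪯b , max = true ∷ b , ⪯-∷ (λ ()) x⪯b , max
maxFalse-above {g = g} pos (false ∷ x) gx | true with maxFalse-above (Positive-cof₀ pos) x gx
...   | b , x⪯b , max = false ∷ b , ⪯-∷ (λ ()) x⪯b ,
        cong₂ _∧_ (∧-conicalˡ (not (g (false ∷ b))) _ max)
                  (cong₂ _∧_ (pos (true ∷ x) (true ∷ b) g₁x (⪯-∷ (λ 1≡1 → 1≡1) x⪯b))
                             (∧-conicalʳ (not (g (false ∷ b))) _ max))

minTrue-least : ∀ {n} {f : BF n} → Positive f → ∀ {x y} → minTrue f x ≡ true → y ⪯ x → f y ≡ true → y ≡ x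
minTrue-least pos {[]}        {[]}        min y⪯x fy = refl
minTrue-least pos {false ∷ x} {false ∷ y} min y⪯x fy =
  cong (false ∷_) (minTrue-least (Positive-cof₀ pos) min (y⪯x ∘ suc) fy)
minTrue-least pos {false ∷ x} {true ∷ y}  min y⪯x fy = contradiction (y⪯x zero refl) λ ()
minTrue-least {f = f} pos {true ∷ x}  {true ∷ y}  min y⪯x fy =
  cong (true ∷_) (minTrue-least (Positive-cof₁ pos) min₁ (y⪯x ∘ suc) fy)
  where
  min₁ : minTrue (cof₁ f) x ≡ true
  min₁ = cong₂ _∧_ (∧-conicalˡ (f (true ∷ x)) _ min)
                   (∧-conicalʳ (not (f (false ∷ x))) _ (∧-conicalʳ (f (true ∷ x)) _ min))
minTrue-least {f = f} pos {true ∷ x}  {false ∷ y} min y⪯x fy = contradiction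
  (trans (sym (pos (false ∷ y) (false ∷ x) fy (⪯-∷ (λ ()) (y⪯x ∘ suc))))
         (not-true (∧-conicalˡ _ (belowFalse (cof₁ f) x) (∧-conicalʳ (f (true ∷ x)) _ min)))) λ ()

maxFalse-greatest : ∀ {n} {f : BF n} → Positive f → ∀ {x y} → maxFalse f x ≡ true → x ⪯ y → f y ≡ false → x ≡ y
maxFalse-greatest pos {[]}        {[]}        max x⪯y fy = refl
maxFalse-greatest pos {true ∷ x}  {true ∷ y}  max x⪯y fy =
  cong (true ∷_) (maxFalse-greatest (Positive-cof₁ pos) max (x⪯y ∘ suc) fy)
maxFalse-greatest pos {true ∷ x}  {false ∷ y} max x⪯y fy = contradiction (x⪯y zero refl) λ ()
maxFalse-greatest {f = f} pos {false ∷ x} {false ∷ y} max x⪯y fy =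
  cong (false ∷_) (maxFalse-greatest (Positive-cof₀ pos) max₀ (x⪯y ∘ suc) fy)
  where
  max₀ : maxFalse (cof₀ f) x ≡ true
  max₀ = cong₂ _∧_ (∧-conicalˡ (not (f (false ∷ x))) _ max)
                   (∧-conicalʳ (f (true ∷ x)) _ (∧-conicalʳ (not (f (false ∷ x))) _ max))
maxFalse-greatest {f = f} pos {false ∷ x} {true ∷ y}  max x⪯y fy = contradiction
  (trans (sym (∧-conicalˡ _ (aboveTrue (cof₀ f) x) (∧-conicalʳ (not (f (false ∷ x))) _ max)))
         (Positive-false pos {true ∷ x} {true ∷ y} (⪯-∷ (λ 1≡1 → 1≡1) (x⪯y ∘ suc)) fy)) λ ()

minTrue⇒MinimalTrue : ∀ {n} {f : BF n} → Positive f → ∀ {x} → minTrue f x ≡ true → MinimalTrue f x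
minTrue⇒MinimalTrue {f = f} pos {x} min = ∧-conicalˡ _ _ min , smaller-false
  where
  smaller-false : ∀ y → y ⪯ x → ¬ x ≡ y → f y ≡ false
  smaller-false y y⪯x x≢y with f y in fy
  ... | false = refl
  ... | true  = contradiction (sym (minTrue-least pos min y⪯x fy)) x≢y

maxFalse⇒MaximalFalse : ∀ {n} {f : BF n} → Positive f → ∀ {x} → maxFalse f x ≡ true → MaximalFalse f x
maxFalse⇒MaximalFalse {f = f} pos {x} max = not-true (∧-conicalˡ _ _ max) , larger-true
  where
  larger-true : ∀ y → x ⪯ y → ¬ x ≡ y → f y ≡ true
  larger-true y x⪯y x≢y with f y in fy
  ... | true  = refl
  ... | false = contradiction (maxFalse-greatest pos max x⪯y fy) x≢y

-- profile (glue u v) (b ∷ x) reduces to glue_b (profile u x) (profile v x), and likewise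
-- profile f (b ∷ x) to glue_b (profile (cof₀ f) x) (profile (cof₁ f) x).
glue₀ glue₁ : Profile → Profile → Profile
glue₀ π ρ = ⟨ value π , below π , value ρ ∧ above π ⟩
glue₁ π ρ = ⟨ value ρ , not (value π) ∧ below ρ , above ρ ⟩

profile-insertAt : ∀ {n} (f : BF (suc n)) w b x → profile f (insertAt x w b) ≡ profile (toFront w f) (b ∷ x)
profile-insertAt f w false x = cong₂ (λ β α → ⟨ f (insertAt x w false) , β , α ⟩)
  (belowFalse-insertAt-false f w x) (aboveTrue-insertAt-false f w x)
profile-insertAt f w true  x = cong₂ (λ β α → ⟨ f (insertAt x w true) , β , α ⟩)
  (belowFalse-insertAt-true f w x) (aboveTrue-insertAt-true f w x)

extremalᵖ : Profile → ℕ
extremalᵖ π = toℕ (isMinTrue π) + toℕ (isMaxFalse π)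

newExtremalᵖ : Profile → Profile → ℕ
newExtremalᵖ π ρ = toℕ (isMinTrue ρ ∧ not (isMinTrue π)) + toℕ (isMaxFalse ρ ∧ not (isMaxFalse π))

extremalCount : ∀ {n} → BF n → ℕ
extremalCount f = sumCube (λ x → extremalᵖ (profile f x))

newExtremalCount : ∀ {n} → BF n → BF n → ℕ
newExtremalCount h g = sumCube (λ x → newExtremalᵖ (profile h x) (profile g x))

commonMinTrue : ∀ {n} → BF n → BF n → ℕ
commonMinTrue u p = sumCube (λ x → toℕ (minTrue p x ∧ minTrue u x))

sumCube-toFront : ∀ {n} (c : Profile → Profile → ℕ) (h g : BF (suc n)) w →
  sumCube (λ y → c (profile h y) (profile g y))
    ≡ sumCube (λ y → c (profile (toFront w h) y) (profile (toFront w g) y))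
sumCube-toFront c h g w =
  trans (sumCube-insertAt (λ y → c (profile h y) (profile g y)) w) (cong₂ _+_ (moved false) (moved true))
  where
  moved : ∀ b → sumCube (λ x → c (profile h (insertAt x w b)) (profile g (insertAt x w b)))
              ≡ sumCube (λ x → c (profile (toFront w h) (b ∷ x)) (profile (toFront w g) (b ∷ x)))
  moved b = sumCube-cong (λ x → cong₂ c (profile-insertAt h w b x) (profile-insertAt g w b x))

extremalCount-toFront : ∀ {n} (f : BF (suc n)) w → extremalCount (toFront w f) ≡ extremalCount f
extremalCount-toFront f w = sym (sumCube-toFront (λ _ ρ → extremalᵖ ρ) f f w)

newExtremalCount-toFront : ∀ {n} (h g : BF (suc n)) w →
  newExtremalCount (toFront w h) (toFront w g) ≡ newExtremalCount h g
newExtremalCount-toFront h g w = sym (sumCube-toFront newExtremalᵖ h g w)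

1≤newExtremalᵖ : ∀ {π ρ} → value π ≡ false → isMinTrue ρ ≡ true → 1 ≤ newExtremalᵖ π ρ
1≤newExtremalᵖ {π} vπ mρ = ≤-trans
  (≤-reflexive (cong toℕ (sym (cong₂ (λ r m → r ∧ not m) mρ (cong (_∧ below π) vπ)))))
  (m≤m+n _ _)

differ≤newExtremalCount : ∀ {n} {h g : BF n} → Positive h → Positive g → h ≤ᶠ g →
  toℕ (differ h g) ≤ newExtremalCount h g
differ≤newExtremalCount {h = h} {g} ph pg h≤g with differ h g in h≢g
... | false = z≤n
... | true with differ-true h≤g h≢g
...   | x , hx , gx with minTrue-below pg x gx
...     | a , a⪯x , min =
  ≤-trans (1≤newExtremalᵖ {profile h a} {profile g a} (Positive-false ph a⪯x hx) min) (point≤sumCube _ a)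

maxFalse-separating : ∀ {n} {u v : BF n} → Positive u → Positive v → u ≤ᶠ v → differ u v ≡ true →
  1 ≤ sumCube (λ x → toℕ (maxFalse u x ∧ v x))
maxFalse-separating pu pv u≤v u≢v with differ-true u≤v u≢v
... | x , ux , vx with maxFalse-above pu x ux
...   | b , x⪯b , max =
  ≤-trans (≤-reflexive (cong toℕ (sym (cong₂ _∧_ max (pv x b vx x⪯b))))) (point≤sumCube _ b)

_≟ᵛ_ : ∀ {n} → DecidableEquality (Vec Bool n)
_≟ᵛ_ = ≡-dec _≟ᵇ_

multiplicity : ∀ {n} → Vec Bool n → List (Vec Bool n) → ℕ
multiplicity x []      = 0
multiplicity x (e ∷ E) = toℕ (does (x ≟ᵛ e)) + multiplicity x E

sumCube-indicator : ∀ {n} (e : Vec Bool n) → sumCube (λ x → toℕ (does (x ≟ᵛ e))) ≡ 1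
sumCube-indicator         []          = refl
sumCube-indicator {suc n} (false ∷ e) = cong₂ _+_ (sumCube-indicator e) (sumCube-zero n)
sumCube-indicator {suc n} (true ∷ e)  = cong₂ _+_ (sumCube-zero n) (sumCube-indicator e)

sumCube-multiplicity : ∀ {n} (E : List (Vec Bool n)) → sumCube (λ x → multiplicity x E) ≡ length E
sumCube-multiplicity {n} []      = sumCube-zero n
sumCube-multiplicity     (e ∷ E) = trans
  (sumCube-distrib-+ (λ x → toℕ (does (x ≟ᵛ e))) (λ x → multiplicity x E))
  (cong₂ _+_ (sumCube-indicator e) (sumCube-multiplicity E))

∈⇒1≤multiplicity : ∀ {n} {x : Vec Bool n} {E} → x LM.∈ E → 1 ≤ multiplicity x E
∈⇒1≤multiplicity {x = x} (here refl) =
  ≤-trans (≤-reflexive (cong toℕ (sym (dec-true (x ≟ᵛ x) refl)))) (m≤m+n _ _)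
∈⇒1≤multiplicity         (there x∈E) = ≤-trans (∈⇒1≤multiplicity x∈E) (m≤n+m _ _)

extremalᵖ≤ : ∀ π {k} → (isMinTrue π ≡ true → 1 ≤ k) → (isMaxFalse π ≡ true → 1 ≤ k) → extremalᵖ π ≤ k
extremalᵖ≤ ⟨ true  , true  , _     ⟩ min max = min refl
extremalᵖ≤ ⟨ true  , false , _     ⟩ min max = z≤n
extremalᵖ≤ ⟨ false , _     , true  ⟩ min max = max refl
extremalᵖ≤ ⟨ false , _     , false ⟩ min max = z≤n

extremalCount≤length : ∀ {n} {f : BF n} → Positive f → (E : List (Vec Bool n)) →
  (∀ x → (x LM.∈ E) ⇔ Extremal f x) → extremalCount f ≤ length E
extremalCount≤length {f = f} pos E E⇔Extremal = ≤-trans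
  (sumCube-mono-≤ λ x → extremalᵖ≤ (profile f x)
    (λ min → ∈⇒1≤multiplicity (Equivalence.from (E⇔Extremal x) (inj₂ (minTrue⇒MinimalTrue pos min))))
    (λ max → ∈⇒1≤multiplicity (Equivalence.from (E⇔Extremal x) (inj₁ (maxFalse⇒MaximalFalse pos max)))))
  (≤-reflexive (sumCube-multiplicity E))

-- The pointwise content of each counting step below is an inequality between a few profiles; it is
-- checked by evaluating it on all of them.

infixr 3 _⇒ᵇ_
_⇒ᵇ_ : Bool → Bool → Bool
a ⇒ᵇ b = not a ∨ b

⇒ᵇ-intro : ∀ {a b} → (a ≡ true → b ≡ true) → T (a ⇒ᵇ b)
⇒ᵇ-intro {false} a⇒b = tt
⇒ᵇ-intro {true}  a⇒b with a⇒b refl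
... | refl = tt

infixl 1 _▸_
_▸_ : ∀ {a b} → T (a ⇒ᵇ b) → T a → T b
_▸_ {true} b _ = b

infix 4 _≼_
_≼_ : Profile → Profile → Bool
π ≼ ρ = (value π ⇒ᵇ value ρ) ∧ (below ρ ⇒ᵇ below π) ∧ (above π ⇒ᵇ above ρ)

profile-mono : ∀ {n} {u v : BF n} → u ≤ᶠ v → ∀ x → T (profile u x ≼ profile v x)
profile-mono u≤v x = Equivalence.from T-∧
  (⇒ᵇ-intro (u≤v x) , Equivalence.from T-∧ (⇒ᵇ-intro (belowFalse-anti u≤v x) , ⇒ᵇ-intro (aboveTrue-mono u≤v x)))

allBool : (Bool → Bool) → Bool
allBool P = P false ∧ P true

allBool-sound : ∀ P → T (allBool P) → ∀ b → T (P b)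
allBool-sound P all false = proj₁ (Equivalence.to T-∧ all)
allBool-sound P all true  = proj₂ (Equivalence.to T-∧ all)

allProfiles : (Profile → Bool) → Bool
allProfiles P = allBool λ a → allBool λ b → allBool λ c → P ⟨ a , b , c ⟩

allProfiles-sound : ∀ P → T (allProfiles P) → ∀ π → T (P π)
allProfiles-sound P all ⟨ a , b , c ⟩ =
  allBool-sound (λ c → P ⟨ a , b , c ⟩)
    (allBool-sound (λ b → allBool λ c → P ⟨ a , b , c ⟩)
      (allBool-sound (λ a → allBool λ b → allBool λ c → P ⟨ a , b , c ⟩) all a) b) c

allᴾ : ∀ n → N-ary n Profile Bool → Bool
allᴾ zero    b = b
allᴾ (suc n) P = allProfiles (λ π → allᴾ n (P π))

allᴾ-sound : ∀ n (P : N-ary n Profile Bool) → T (allᴾ n P) → ∀ πs → T (P $ⁿ πs)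
allᴾ-sound zero    P all []       = all
allᴾ-sound (suc n) P all (π ∷ πs) = allᴾ-sound n (P π) (allProfiles-sound (λ π → allᴾ n (P π)) all π) πs

cofactor-table : ∀ π ρ → T (π ≼ ρ) →
  extremalᵖ π + newExtremalᵖ π ρ ≤ extremalᵖ (glue₀ π ρ) + extremalᵖ (glue₁ π ρ)
cofactor-table π ρ π≼ρ = ≤ᵇ⇒≤ _ _ (allᴾ-sound 2 table tt (π ∷ ρ ∷ []) ▸ π≼ρ)
  where
  table : Profile → Profile → Bool
  table π ρ = π ≼ ρ ⇒ᵇ
    extremalᵖ π + newExtremalᵖ π ρ ≤ᵇ extremalᵖ (glue₀ π ρ) + extremalᵖ (glue₁ π ρ)

newExtremalᵖ-glue : Profile → Profile → Profile → Profile → ℕ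
newExtremalᵖ-glue h₀ h₁ g₀ g₁ =
  newExtremalᵖ (glue₀ h₀ h₁) (glue₀ g₀ g₁) + newExtremalᵖ (glue₁ h₀ h₁) (glue₁ g₀ g₁)

split-table : ∀ h₀ h₁ g₀ g₁ → T (h₀ ≼ h₁) → T (h₁ ≼ h₀) → T (h₀ ≼ g₀) → T (g₀ ≼ g₁) →
  newExtremalᵖ h₀ g₀ + newExtremalᵖ g₀ g₁ ≤ newExtremalᵖ-glue h₀ h₁ g₀ g₁
split-table h₀ h₁ g₀ g₁ p₁ p₂ p₃ p₄ =
  ≤ᵇ⇒≤ _ _ (allᴾ-sound 4 table tt (h₀ ∷ h₁ ∷ g₀ ∷ g₁ ∷ []) ▸ p₁ ▸ p₂ ▸ p₃ ▸ p₄)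
  where
  table : Profile → Profile → Profile → Profile → Bool
  table h₀ h₁ g₀ g₁ = h₀ ≼ h₁ ⇒ᵇ h₁ ≼ h₀ ⇒ᵇ h₀ ≼ g₀ ⇒ᵇ g₀ ≼ g₁ ⇒ᵇ
    newExtremalᵖ h₀ g₀ + newExtremalᵖ g₀ g₁ ≤ᵇ newExtremalᵖ-glue h₀ h₁ g₀ g₁

merge-table : ∀ h₀ h₁ g₀ g₁ → T (h₀ ≼ h₁) → T (h₁ ≼ h₀) → T (h₀ ≼ g₀) → T (g₀ ≼ h₀) → T (h₀ ≼ g₁) →
  newExtremalᵖ h₀ g₁ + toℕ (isMaxFalse h₀ ∧ value g₁) ≤ newExtremalᵖ-glue h₀ h₁ g₀ g₁
merge-table h₀ h₁ g₀ g₁ p₁ p₂ p₃ p₄ p₅ =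
  ≤ᵇ⇒≤ _ _ (allᴾ-sound 4 table tt (h₀ ∷ h₁ ∷ g₀ ∷ g₁ ∷ []) ▸ p₁ ▸ p₂ ▸ p₃ ▸ p₄ ▸ p₅)
  where
  table : Profile → Profile → Profile → Profile → Bool
  table h₀ h₁ g₀ g₁ = h₀ ≼ h₁ ⇒ᵇ h₁ ≼ h₀ ⇒ᵇ h₀ ≼ g₀ ⇒ᵇ g₀ ≼ h₀ ⇒ᵇ h₀ ≼ g₁ ⇒ᵇ
    newExtremalᵖ h₀ g₁ + toℕ (isMaxFalse h₀ ∧ value g₁) ≤ᵇ newExtremalᵖ-glue h₀ h₁ g₀ g₁

offCornerᵖ : Profile → Profile → Profile → Profile → ℕ
offCornerᵖ h₀ h₁ g₀ g₁ = extremalᵖ (glue₁ h₀ h₁) + newExtremalᵖ-glue h₀ h₁ g₀ g₁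

CornerPremises : Profile → Profile → Bool
CornerPremises h₀ g₀ = not (value h₀) ∧ (above h₀ ⇒ᵇ value g₀)

offCorner-table : ∀ h₀ h₁ g₀ g₁ → T (CornerPremises h₀ g₀) → T (g₀ ≼ g₁) → T (h₁ ≼ g₁) →
  extremalᵖ h₁ + (newExtremalᵖ h₁ g₁ + newExtremalᵖ g₁ g₀) ≤ offCornerᵖ h₀ h₁ g₀ g₁
offCorner-table h₀ h₁ g₀ g₁ p₁ p₂ p₃ =
  ≤ᵇ⇒≤ _ _ (allᴾ-sound 4 table tt (h₀ ∷ h₁ ∷ g₀ ∷ g₁ ∷ []) ▸ p₁ ▸ p₂ ▸ p₃)
  where
  table : Profile → Profile → Profile → Profile → Bool
  table h₀ h₁ g₀ g₁ = CornerPremises h₀ g₀ ⇒ᵇ g₀ ≼ g₁ ⇒ᵇ h₁ ≼ g₁ ⇒ᵇ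
    extremalᵖ h₁ + (newExtremalᵖ h₁ g₁ + newExtremalᵖ g₁ g₀) ≤ᵇ offCornerᵖ h₀ h₁ g₀ g₁

offCorner-table-g₀≗g₁ : ∀ h₀ h₁ g₀ g₁ → T (CornerPremises h₀ g₀) → T (g₀ ≼ g₁) → T (g₁ ≼ g₀) → T (h₁ ≼ g₁) →
  extremalᵖ (glue₀ h₁ g₁) + extremalᵖ (glue₁ h₁ g₁) + toℕ (isMinTrue g₁ ∧ isMinTrue h₁) ≤ offCornerᵖ h₀ h₁ g₀ g₁
offCorner-table-g₀≗g₁ h₀ h₁ g₀ g₁ p₁ p₂ p₃ p₄ =
  ≤ᵇ⇒≤ _ _ (allᴾ-sound 4 table tt (h₀ ∷ h₁ ∷ g₀ ∷ g₁ ∷ []) ▸ p₁ ▸ p₂ ▸ p₃ ▸ p₄)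
  where
  table : Profile → Profile → Profile → Profile → Bool
  table h₀ h₁ g₀ g₁ = CornerPremises h₀ g₀ ⇒ᵇ g₀ ≼ g₁ ⇒ᵇ g₁ ≼ g₀ ⇒ᵇ h₁ ≼ g₁ ⇒ᵇ
    extremalᵖ (glue₀ h₁ g₁) + extremalᵖ (glue₁ h₁ g₁) + toℕ (isMinTrue g₁ ∧ isMinTrue h₁)
      ≤ᵇ offCornerᵖ h₀ h₁ g₀ g₁

offCorner-table-h₁≗g₁ : ∀ h₀ h₁ g₀ g₁ → T (CornerPremises h₀ g₀) → T (g₀ ≼ g₁) → T (h₁ ≼ g₁) → T (g₁ ≼ h₁) →
  extremalᵖ (glue₀ g₀ g₁) + extremalᵖ (glue₁ g₀ g₁) + toℕ (isMinTrue g₁ ∧ isMinTrue g₀) ≤ offCornerᵖ h₀ h₁ g₀ g₁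
offCorner-table-h₁≗g₁ h₀ h₁ g₀ g₁ p₁ p₂ p₃ p₄ =
  ≤ᵇ⇒≤ _ _ (allᴾ-sound 4 table tt (h₀ ∷ h₁ ∷ g₀ ∷ g₁ ∷ []) ▸ p₁ ▸ p₂ ▸ p₃ ▸ p₄)
  where
  table : Profile → Profile → Profile → Profile → Bool
  table h₀ h₁ g₀ g₁ = CornerPremises h₀ g₀ ⇒ᵇ g₀ ≼ g₁ ⇒ᵇ h₁ ≼ g₁ ⇒ᵇ g₁ ≼ h₁ ⇒ᵇ
    extremalᵖ (glue₀ g₀ g₁) + extremalᵖ (glue₁ g₀ g₁) + toℕ (isMinTrue g₁ ∧ isMinTrue g₀)
      ≤ᵇ offCornerᵖ h₀ h₁ g₀ g₁

extremalCount-cofactors : ∀ {n} {f : BF (suc n)} → Positive f →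
  extremalCount (cof₀ f) + newExtremalCount (cof₀ f) (cof₁ f) ≤ extremalCount f
extremalCount-cofactors {f = f} pos = sumCube-+-mono-≤ λ x →
  cofactor-table (profile (cof₀ f) x) (profile (cof₁ f) x) (profile-mono (cof₀≤ᶠcof₁ pos) x)

newExtremalCount-split : ∀ {n} {h₀ h₁ g₀ g₁ : BF n} → h₀ ≗ h₁ → h₀ ≤ᶠ g₀ → g₀ ≤ᶠ g₁ →
  newExtremalCount h₀ g₀ + newExtremalCount g₀ g₁ ≤ newExtremalCount (glue h₀ h₁) (glue g₀ g₁)
newExtremalCount-split {h₀ = h₀} {h₁} {g₀} {g₁} h₀≗h₁ h₀≤g₀ g₀≤g₁ = sumCube-+-mono-≤ λ x →
  split-table (profile h₀ x) (profile h₁ x) (profile g₀ x) (profile g₁ x)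
    (profile-mono (≗⇒≤ᶠ h₀≗h₁) x) (profile-mono (≗⇒≤ᶠ (sym ∘ h₀≗h₁)) x)
    (profile-mono h₀≤g₀ x) (profile-mono g₀≤g₁ x)

newExtremalCount-merge : ∀ {n} {h₀ h₁ g₀ g₁ : BF n} → h₀ ≗ h₁ → h₀ ≗ g₀ → h₀ ≤ᶠ g₁ →
  newExtremalCount h₀ g₁ + sumCube (λ x → toℕ (maxFalse h₀ x ∧ g₁ x))
    ≤ newExtremalCount (glue h₀ h₁) (glue g₀ g₁)
newExtremalCount-merge {h₀ = h₀} {h₁} {g₀} {g₁} h₀≗h₁ h₀≗g₀ h₀≤g₁ = sumCube-+-mono-≤ λ x →
  merge-table (profile h₀ x) (profile h₁ x) (profile g₀ x) (profile g₁ x)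
  (profile-mono (≗⇒≤ᶠ h₀≗h₁) x) (profile-mono (≗⇒≤ᶠ (sym ∘ h₀≗h₁)) x)
  (profile-mono (≗⇒≤ᶠ h₀≗g₀) x) (profile-mono (≗⇒≤ᶠ (sym ∘ h₀≗g₀)) x) (profile-mono h₀≤g₁ x)

-- Duality

dual : ∀ {n} → BF n → BF n
dual f x = not (f (map not x))

dualᵖ : Profile → Profile
dualᵖ π = ⟨ not (value π) , above π , below π ⟩

belowFalse-dual : ∀ {n} (f : BF n) x → belowFalse (dual f) x ≡ aboveTrue f (map not x)
belowFalse-dual f []          = refl
belowFalse-dual f (false ∷ x) = belowFalse-dual (cof₁ f) x
belowFalse-dual f (true ∷ x)  = cong₂ _∧_ (not-involutive (f (true ∷ map not x))) (belowFalse-dual (cof₀ f) x)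

aboveTrue-dual : ∀ {n} (f : BF n) x → aboveTrue (dual f) x ≡ belowFalse f (map not x)
aboveTrue-dual f []          = refl
aboveTrue-dual f (true ∷ x)  = aboveTrue-dual (cof₀ f) x
aboveTrue-dual f (false ∷ x) = cong (not (f (false ∷ map not x)) ∧_) (aboveTrue-dual (cof₁ f) x)

profile-dual : ∀ {n} (f : BF n) x → profile (dual f) x ≡ dualᵖ (profile f (map not x))
profile-dual f x = cong₂ (λ β α → ⟨ dual f x , β , α ⟩) (belowFalse-dual f x) (aboveTrue-dual f x)

newExtremalᵖ-dual : ∀ π ρ → newExtremalᵖ (dualᵖ π) (dualᵖ ρ) ≡ newExtremalᵖ π ρ
newExtremalᵖ-dual ⟨ a , b , c ⟩ ⟨ a′ , b′ , c′ ⟩ = trans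
  (cong₂ (λ u v → toℕ ((not a′ ∧ c′) ∧ not (not a ∧ c)) + toℕ ((u ∧ b′) ∧ not (v ∧ b)))
         (not-involutive a′) (not-involutive a))
  (+-comm (toℕ ((not a′ ∧ c′) ∧ not (not a ∧ c))) (toℕ ((a′ ∧ b′) ∧ not (a ∧ b))))

newExtremalCount-dual : ∀ {n} (h g : BF n) → newExtremalCount (dual h) (dual g) ≡ newExtremalCount h g
newExtremalCount-dual h g = trans
  (sumCube-cong λ x → trans (cong₂ newExtremalᵖ (profile-dual h x) (profile-dual g x))
                                 (newExtremalᵖ-dual (profile h (map not x)) (profile g (map not x))))
  (sym (sumCube-map-not (λ x → newExtremalᵖ (profile h x) (profile g x))))

differ-dual : ∀ {n} (h g : BF n) → differ (dual h) (dual g) ≡ differ h g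
differ-dual h g = trans
  (anyPoint-cong λ x → xor-annihilates-not (h (map not x)) (g (map not x)))
  (sym (anyPoint-map-not (λ x → h x xor g x)))

relevant-dual : ∀ {n} (f : BF n) → relevant (dual f) ≡ relevant f
relevant-dual {zero}  f = refl
relevant-dual {suc n} f = cong₂ _∷_
  (trans (differ-dual (cof₁ f) (cof₀ f)) (differ-comm (cof₁ f) (cof₀ f)))
  (trans (cong₂ _∪_ (relevant-dual (cof₁ f)) (relevant-dual (cof₀ f)))
         (∪-comm (relevant (cof₁ f)) (relevant (cof₀ f))))

map-not-anti-⪯ : ∀ {n} {x y : Vec Bool n} → x ⪯ y → map not y ⪯ map not x
map-not-anti-⪯ {x = a ∷ x} {b ∷ y} x⪯y zero    = contrapositive (x⪯y zero)
  where
  contrapositive : ∀ {a b} → (a ≡ true → b ≡ true) → not b ≡ true → not a ≡ true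
  contrapositive {false} a⇒b ¬b = refl
  contrapositive {true}  a⇒b ¬b = contradiction (trans (sym (a⇒b refl)) (not-true ¬b)) λ ()
map-not-anti-⪯ {x = a ∷ x} {b ∷ y} x⪯y (suc j) = map-not-anti-⪯ {x = x} {y} (x⪯y ∘ suc) j

Positive-dual : ∀ {n} {f : BF n} → Positive f → Positive (dual f)
Positive-dual pos x y fx x⪯y = cong not (Positive-false pos (map-not-anti-⪯ {x = x} {y} x⪯y) (not-true fx))

dual-anti : ∀ {n} {h g : BF n} → g ≤ᶠ h → dual h ≤ᶠ dual g
dual-anti g≤h x hx = cong not (≤ᶠ-false g≤h (map not x) (not-true hx))

-- Variables relevant for only one of two comparable functions

NewRelevantBound : ℕ → Set
NewRelevantBound n = ∀ {h g : BF n} → Positive h → Positive g → h ≤ᶠ g →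
  toℕ (differ h g) + newRelevantCount h g ≤ newExtremalCount h g

module _ {n} (IH : NewRelevantBound n) {h₀ h₁ g₀ g₁ : BF n}
         (ph₀ : Positive h₀) (pg₀ : Positive g₀) (pg₁ : Positive g₁)
         (h₀≗h₁ : h₀ ≗ h₁) (h₀≤g₀ : h₀ ≤ᶠ g₀) (g₀≤g₁ : g₀ ≤ᶠ g₁) (g₀≢g₁ : differ g₀ g₁ ≡ true) where

  private
    N : ℕ
    N = newExtremalCount (glue h₀ h₁) (glue g₀ g₁)

    bound-h₀≢g₀ : differ h₀ g₀ ≡ true →
      1 + (1 + (newRelevantCount h₀ g₀ + newRelevantCount g₀ g₁)) ≤ N
    bound-h₀≢g₀ h₀≢g₀ = begin
      1 + (1 + (W₀ + W₁))                                  ≡⟨ cong suc (sym (+-suc W₀ W₁)) ⟩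
      (1 + W₀) + (1 + W₁)                                  ≡⟨ cong₂ (λ d e → (toℕ d + W₀) + (toℕ e + W₁))
                                                                    (sym h₀≢g₀) (sym g₀≢g₁) ⟩
      (toℕ (differ h₀ g₀) + W₀) + (toℕ (differ g₀ g₁) + W₁) ≤⟨ +-mono-≤ (IH ph₀ pg₀ h₀≤g₀) (IH pg₀ pg₁ g₀≤g₁) ⟩
      newExtremalCount h₀ g₀ + newExtremalCount g₀ g₁      ≤⟨ newExtremalCount-split h₀≗h₁ h₀≤g₀ g₀≤g₁ ⟩
      N                                                    ∎
      where
      open ≤-Reasoning
      W₀ = newRelevantCount h₀ g₀
      W₁ = newRelevantCount g₀ g₁

    bound-h₀≗g₀ : h₀ ≗ g₀ →
      1 + (1 + (newRelevantCount h₀ g₀ + newRelevantCount g₀ g₁)) ≤ N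
    bound-h₀≗g₀ h₀≗g₀ = begin
      1 + (1 + (newRelevantCount h₀ g₀ + newRelevantCount g₀ g₁))
        ≡⟨ cong₂ (λ k l → 1 + (1 + (k + l))) W₀≡0 W₁≡W ⟩
      1 + (1 + W)                                        ≡⟨ +-comm 1 (1 + W) ⟩
      (1 + W) + 1                                        ≡⟨ cong (λ d → (toℕ d + W) + 1) (sym h₀≢g₁) ⟩
      (toℕ (differ h₀ g₁) + W) + 1                       ≤⟨ +-mono-≤ (IH ph₀ pg₁ h₀≤g₁)
                                                                     (maxFalse-separating ph₀ pg₁ h₀≤g₁ h₀≢g₁) ⟩
      newExtremalCount h₀ g₁ + sumCube (λ x → toℕ (maxFalse h₀ x ∧ g₁ x))
                                                         ≤⟨ newExtremalCount-merge h₀≗h₁ h₀≗g₀ h₀≤g₁ ⟩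
      N                                                  ∎
      where
      open ≤-Reasoning
      W = newRelevantCount h₀ g₁
      h₀≤g₁ : h₀ ≤ᶠ g₁
      h₀≤g₁ x h₀x = g₀≤g₁ x (h₀≤g₀ x h₀x)
      relevant-g₀ : relevant g₀ ≡ relevant h₀
      relevant-g₀ = relevant-cong (sym ∘ h₀≗g₀)
      W₀≡0 : newRelevantCount h₀ g₀ ≡ 0
      W₀≡0 = trans (cong (λ r → ∣ r ─ relevant h₀ ∣) relevant-g₀) (∣p─p∣≡0 (relevant h₀))
      W₁≡W : newRelevantCount g₀ g₁ ≡ W
      W₁≡W = cong (λ r → ∣ relevant g₁ ─ r ∣) relevant-g₀
      h₀≢g₁ : differ h₀ g₁ ≡ true
      h₀≢g₁ = trans (differ-cong h₀≗g₀ (λ _ → refl)) g₀≢g₁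

    differ+newRelevant-glue :
      toℕ (differ (glue h₀ h₁) (glue g₀ g₁)) + newRelevantCount (glue h₀ h₁) (glue g₀ g₁)
        ≤ 1 + (1 + (newRelevantCount h₀ g₀ + newRelevantCount g₀ g₁))
    differ+newRelevant-glue =
      +-mono-≤ (toℕ≤1 (differ (glue h₀ h₁) (glue g₀ g₁))) (∣relevant-glue─relevant-glue∣ h₀ h₁ g₀ g₁)

  newRelevant-glue-bound : toℕ (differ (glue h₀ h₁) (glue g₀ g₁)) + newRelevantCount (glue h₀ h₁) (glue g₀ g₁)
                           ≤ newExtremalCount (glue h₀ h₁) (glue g₀ g₁)
  newRelevant-glue-bound = ≤-trans differ+newRelevant-glue (by-cases (differ h₀ g₀) refl)
    where
    -- not a `with`: it would also abstract the copy of differ h₀ g₀ inside differ (glue h₀ h₁) (glue g₀ g₁)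
    by-cases : ∀ d → differ h₀ g₀ ≡ d → 1 + (1 + (newRelevantCount h₀ g₀ + newRelevantCount g₀ g₁)) ≤ N
    by-cases true  h₀≢g₀ = bound-h₀≢g₀ h₀≢g₀
    by-cases false h₀≡g₀ = bound-h₀≗g₀ (differ-false h₀≡g₀)

newRelevant-bound : ∀ {n} → NewRelevantBound n
newRelevant-bound {zero} ph pg h≤g =
  ≤-trans (≤-reflexive (+-identityʳ _)) (differ≤newExtremalCount ph pg h≤g)
newRelevant-bound {suc n} {h} {g} ph pg h≤g with nonempty? (relevant g ─ relevant h)
... | no none = begin
  toℕ (differ h g) + newRelevantCount h g ≡⟨ cong (toℕ (differ h g) +_) no-new ⟩
  toℕ (differ h g) + 0                    ≡⟨ +-identityʳ _ ⟩
  toℕ (differ h g)                        ≤⟨ differ≤newExtremalCount ph pg h≤g ⟩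
  newExtremalCount h g                    ∎
  where
  open ≤-Reasoning
  no-new : newRelevantCount h g ≡ 0
  no-new = trans (cong ∣_∣ (Empty-unique none)) (∣⊥∣≡0 (suc n))
... | yes (w , w∈) = begin
  toℕ (differ h g) + newRelevantCount h g
    ≡⟨ sym (cong₂ _+_ (cong toℕ (differ-toFront h g w)) (∣relevant-toFront─relevant-toFront∣ h g w)) ⟩
  toℕ (differ (toFront w h) (toFront w g)) + newRelevantCount (toFront w h) (toFront w g)
    ≤⟨ newRelevant-glue-bound newRelevant-bound (Positive-restrict ph w false)
         (Positive-restrict pg w false) (Positive-restrict pg w true)
         h₀≗h₁ (λ x → h≤g (insertAt x w false)) (restrict-≤ᶠ pg w) g₀≢g₁ ⟩
  newExtremalCount (toFront w h) (toFront w g)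
    ≡⟨ newExtremalCount-toFront h g w ⟩
  newExtremalCount h g ∎
  where
  open ≤-Reasoning
  new : lookup (relevant g) w ≡ true × lookup (relevant h) w ≡ false
  new = lookup-─ (relevant g) (relevant h) w ([]=⇒lookup w∈)
  g₀≢g₁ : differ (restrict g w false) (restrict g w true) ≡ true
  g₀≢g₁ = trans (sym (lookup-relevant g w)) (proj₁ new)
  h₀≗h₁ : restrict h w false ≗ restrict h w true
  h₀≗h₁ = differ-false (trans (sym (lookup-relevant h w)) (proj₂ new))

newRelevant-bound-reverse : ∀ {n} {h g : BF n} → Positive h → Positive g → g ≤ᶠ h →
  toℕ (differ h g) + newRelevantCount h g ≤ newExtremalCount h g
newRelevant-bound-reverse {h = h} {g} ph pg g≤h = subst₂ _≤_
  (cong₂ (λ d k → toℕ d + k) (differ-dual h g) (cong₂ (λ r s → ∣ r ─ s ∣) (relevant-dual g) (relevant-dual h)))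
  (newExtremalCount-dual h g)
  (newRelevant-bound (Positive-dual ph) (Positive-dual pg) (dual-anti g≤h))

-- At least k + 1 extremal points

module _ {n} {f : BF (suc n)} (pos : Positive f) (k : ℕ)
         (bound : k + ∣ relevant (cof₀ f) ∣ ≤ extremalCount (cof₀ f)) where

  cofactor-step : k + ∣ relevant f ∣ ≤ extremalCount f
  cofactor-step = begin
    k + ∣ relevant f ∣                     ≤⟨ +-monoʳ-≤ k (∣relevant∣-cofactors f) ⟩
    k + (toℕ d + (∣ relevant h ∣ + W))     ≡⟨ cong (k +_) (+-left-swap (toℕ d) ∣ relevant h ∣ W) ⟩
    k + (∣ relevant h ∣ + (toℕ d + W))     ≡⟨ sym (+-assoc k _ _) ⟩
    (k + ∣ relevant h ∣) + (toℕ d + W)     ≤⟨ +-mono-≤ bound (newRelevant-bound (Positive-cof₀ pos)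
                                                                    (Positive-cof₁ pos) (cof₀≤ᶠcof₁ pos)) ⟩
    extremalCount h + newExtremalCount h g ≤⟨ extremalCount-cofactors pos ⟩
    extremalCount f                        ∎
    where
    open ≤-Reasoning
    h = cof₀ f
    g = cof₁ f
    d = differ h g
    W = newRelevantCount h g

relevant<extremalCount : ∀ {n} {f : BF n} → Positive f → 1 + ∣ relevant f ∣ ≤ extremalCount f
relevant<extremalCount {zero} {f} pos with f []
... | false = ≤-refl
... | true  = ≤-refl
relevant<extremalCount {suc n} pos = cofactor-step pos 1 (relevant<extremalCount (Positive-cof₀ pos))

-- At least k + 2 extremal points for non-split functions

glue-nonSplit : ∀ {n} {u p : BF n} → Positive u → Positive p → u ≤ᶠ p → ¬ ≡0 u → ¬ ≡1 p →
  (∀ v → Avoidable p v) → (∀ x → minTrue p x ∧ minTrue u x ≡ false) → NonSplit (glue u p)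
glue-nonSplit pu pp u≤p u≢0 p≢1 avoid disjoint zero = u≢0 , p≢1
glue-nonSplit {suc n} {u} {p} pu pp u≤p u≢0 p≢1 avoid disjoint (suc v) = no-zero , no-one
  where
  no-zero : ¬ ≡0 (restrict (glue u p) (suc v) false)
  no-zero glue≡0 with avoid v
  ... | y , yᵥ≡0 , py = contradiction (trans (sym p-removed) (glue≡0 (true ∷ removeAt y v))) λ ()
    where
    p-removed : restrict p v false (removeAt y v) ≡ true
    p-removed = trans (subst (λ b → restrict p v b (removeAt y v) ≡ p y) yᵥ≡0 (restrict-lookup p v y)) py
  no-one : ¬ ≡1 (restrict (glue u p) (suc v) true)
  no-one glue≡1 = contradiction (trans (sym common) (disjoint e)) λ ()
    where
    e = insertAt ∅ v true
    p∅ = bottom-false pp p≢1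
    common : minTrue p e ∧ minTrue u e ≡ true
    common = cong₂ _∧_ (minTrue-unit p v p∅ (u≤p e (glue≡1 (false ∷ ∅))))
                       (minTrue-unit u v (≤ᶠ-false u≤p ∅ p∅) (glue≡1 (false ∷ ∅)))

two-minTrue : ∀ {n} {p : BF n} → Positive p → ¬ ≡0 p → ¬ ≡1 p → (∀ v → Avoidable p v) →
  2 ≤ sumCube (λ x → toℕ (minTrue p x))
two-minTrue {p = p} pos p≢0 p≢1 avoid with nonzero-witness p p≢0
... | y , py with minTrue-below pos y py
... | a , _ , min-a with nonempty? a
...   | no a-empty = contradiction (trans (sym (∧-conicalˡ _ _ min-a)) p-a) λ ()
  where
  p-a : p a ≡ false
  p-a = subst (λ t → p t ≡ false) (sym (Empty-unique a-empty)) (bottom-false pos p≢1)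
...   | yes (v , v∈a) with avoid v
...     | y′ , y′ᵥ≡0 , py′ with minTrue-below pos y′ py′
...       | a′ , a′⪯y′ , min-a′ = begin
  2                                     ≡⟨ cong₂ (λ b c → toℕ b + toℕ c) (sym min-a) (sym min-a′) ⟩
  toℕ (minTrue p a) + toℕ (minTrue p a′) ≤⟨ twoPoints≤sumCube (λ x → toℕ (minTrue p x)) a≢a′ ⟩
  sumCube (λ x → toℕ (minTrue p x))     ∎
  where
  open ≤-Reasoning
  a≢a′ : a ≢ a′
  a≢a′ refl = contradiction (trans (sym (a′⪯y′ v ([]=⇒lookup v∈a))) y′ᵥ≡0) λ ()

NonSplitBound : ℕ → Set
NonSplitBound n = ∀ {f : BF (suc n)} → Positive f → NonSplit f → 2 + ∣ relevant f ∣ ≤ extremalCount f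

module _ {n} (IH : NonSplitBound n) {u p : BF n} (pu : Positive u) (pp : Positive p) (u≤p : u ≤ᶠ p)
         (u≢0 : ¬ ≡0 u) (p≢1 : ¬ ≡1 p) (avoid : ∀ v → Avoidable p v) where

  private
    C : ℕ
    C = ∣ relevant u ∪ relevant p ∣

    pglue : Positive (glue u p)
    pglue = Positive-glue pu pp u≤p

  glue-bound : 3 + ∣ relevant u ∪ relevant p ∣ ≤ extremalCount (glue u p) + commonMinTrue u p
  glue-bound with differ u p in u≢p
  ... | false = begin
    3 + C                                ≡⟨ +-comm 2 (1 + C) ⟩
    (1 + C) + 2                          ≡⟨ cong (λ k → (1 + k) + 2) (sym (∣relevant-glue∣ {u = u} {p} u≢p)) ⟩
    (1 + ∣ relevant (glue u p) ∣) + 2    ≤⟨ +-mono-≤ (relevant<extremalCount pglue) two-common ⟩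
    extremalCount (glue u p) + commonMinTrue u p ∎
    where
    open ≤-Reasoning
    two-common : 2 ≤ commonMinTrue u p
    two-common = subst (2 ≤_) (sumCube-cong same) (two-minTrue pp p≢0 p≢1 avoid)
      where
      p≢0 : ¬ ≡0 p
      p≢0 p≡0 = u≢0 λ x → ≤ᶠ-false u≤p x (p≡0 x)
      same : ∀ x → toℕ (minTrue p x) ≡ toℕ (minTrue p x ∧ minTrue u x)
      same x = cong toℕ (trans (sym (∧-idem (minTrue p x)))
                               (cong (minTrue p x ∧_) (minTrue-cong (sym ∘ differ-false u≢p) x)))
  ... | true with anyPoint (λ x → minTrue p x ∧ minTrue u x) in any
  ...   | true = begin
    3 + C                                ≡⟨ +-comm 1 (2 + C) ⟩
    (1 + (1 + C)) + 1                    ≡⟨ cong (λ k → (1 + k) + 1) (sym (∣relevant-glue∣ {u = u} {p} u≢p)) ⟩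
    (1 + ∣ relevant (glue u p) ∣) + 1    ≤⟨ +-mono-≤ (relevant<extremalCount pglue) one-common ⟩
    extremalCount (glue u p) + commonMinTrue u p ∎
    where
    open ≤-Reasoning
    one-common : 1 ≤ commonMinTrue u p
    one-common with anyPoint-sound (λ x → minTrue p x ∧ minTrue u x) any
    ... | x , common =
      ≤-trans (≤-reflexive (cong toℕ (sym common))) (point≤sumCube (λ x → toℕ (minTrue p x ∧ minTrue u x)) x)
  ...   | false = begin
    3 + C                                ≡⟨ sym (+-identityʳ (3 + C)) ⟩
    (2 + (1 + C)) + 0                    ≡⟨ cong (λ k → (2 + k) + 0) (sym (∣relevant-glue∣ {u = u} {p} u≢p)) ⟩
    (2 + ∣ relevant (glue u p) ∣) + 0    ≤⟨ +-mono-≤ (IH pglue nonSplit) z≤n ⟩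
    extremalCount (glue u p) + commonMinTrue u p ∎
    where
    open ≤-Reasoning
    nonSplit : NonSplit (glue u p)
    nonSplit = glue-nonSplit pu pp u≤p u≢0 p≢1 avoid (anyPoint-false (λ x → minTrue p x ∧ minTrue u x) any)

-- f vanishes where x₀ = xᵢ = 0; h₀, h₁, g₀, g₁ are its restrictions to the four quadrants of (x₀, xᵢ).
module Quadrant {n} (IH : NonSplitBound n) {f : BF (suc (suc n))} (pos : Positive f) (ns : NonSplit f)
                (i : Fin (suc n)) (h₀≡0 : ≡0 (restrict (cof₀ f) i false)) where

  private
    h g : BF (suc n)
    h = cof₀ f
    g = cof₁ f

    h₀ h₁ g₀ g₁ : BF n
    h₀ = restrict h i false
    h₁ = restrict h i true
    g₀ = restrict g i false
    g₁ = restrict g i true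

    ph₁ : Positive h₁
    ph₁ = Positive-restrict (Positive-cof₀ pos) i true
    pg₀ : Positive g₀
    pg₀ = Positive-restrict (Positive-cof₁ pos) i false
    pg₁ : Positive g₁
    pg₁ = Positive-restrict (Positive-cof₁ pos) i true

    h₁≤g₁ : h₁ ≤ᶠ g₁
    h₁≤g₁ x = cof₀≤ᶠcof₁ pos (insertAt x i true)
    g₀≤g₁ : g₀ ≤ᶠ g₁
    g₀≤g₁ = restrict-≤ᶠ (Positive-cof₁ pos) i

    h₁≢0 : ¬ ≡0 h₁
    h₁≢0 h₁≡0 = proj₁ (ns zero) (restrictions-≡0 i h₀≡0 h₁≡0)
    h₁≢1 : ¬ ≡1 h₁
    h₁≢1 = restrict-cof₀-nonone pos i (proj₂ (ns (suc i)))
    g₀≢0 : ¬ ≡0 g₀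
    g₀≢0 g₀≡0 = proj₁ (ns (suc i)) λ { (false ∷ x) → h₀≡0 x ; (true ∷ x) → g₀≡0 x }
    g≢1 : ¬ ≡1 g
    g≢1 = proj₂ (ns zero)

    avoid : ∀ v → Avoidable g₁ v
    avoid v = avoidable-restrict (Positive-cof₁ pos) i v
      (restrict-cof₁-nonzero pos (punchIn i v) (proj₁ (ns (suc (punchIn i v)))))

    -- since h₀ ≡ 0, the only point whose upper neighbours are all true for h₀ is the top one
    above-h₀ : ∀ x → aboveTrue h₀ x ≡ true → g₀ x ≡ true
    above-h₀ x up = subst (λ t → g₀ t ≡ true) (sym (aboveTrue-≡0 h₀≡0 x up)) (top-true pg₀ g₀≢0)

    offCorner : Vec Bool n → ℕ
    offCorner x = offCornerᵖ (profile h₀ x) (profile h₁ x) (profile g₀ x) (profile g₁ x)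

    kOffCorner : ℕ
    kOffCorner = ∣ relevant h₁ ∪ (relevant g₀ ∪ relevant g₁) ∣

  offCorner-bound : 1 + sumCube offCorner ≤ extremalCount f
  offCorner-bound = begin
    1 + sumCube offCorner
      ≡⟨ cong (1 +_) offCorner-split ⟩
    1 + (sumCube B + (sumCube C + sumCube D))
      ≤⟨ +-monoˡ-≤ _ corner ⟩
    sumCube A + (sumCube B + (sumCube C + sumCube D))
      ≡⟨ sym (+-assoc (sumCube A) (sumCube B) _) ⟩
    extremalCount (toFront i h) + newExtremalCount (toFront i h) (toFront i g)
      ≡⟨ cong₂ _+_ (extremalCount-toFront h i) (newExtremalCount-toFront h g i) ⟩
    extremalCount h + newExtremalCount h g
      ≤⟨ extremalCount-cofactors pos ⟩
    extremalCount f ∎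
    where
    open ≤-Reasoning
    A B C D : Vec Bool n → ℕ
    A x = extremalᵖ (glue₀ (profile h₀ x) (profile h₁ x))
    B x = extremalᵖ (glue₁ (profile h₀ x) (profile h₁ x))
    C x = newExtremalᵖ (glue₀ (profile h₀ x) (profile h₁ x)) (glue₀ (profile g₀ x) (profile g₁ x))
    D x = newExtremalᵖ (glue₁ (profile h₀ x) (profile h₁ x)) (glue₁ (profile g₀ x) (profile g₁ x))
    offCorner-split : sumCube offCorner ≡ sumCube B + (sumCube C + sumCube D)
    offCorner-split =
      trans (sumCube-distrib-+ B (λ x → C x + D x)) (cong (sumCube B +_) (sumCube-distrib-+ C D))
    corner : 1 ≤ sumCube A
    corner = ≤-trans (≤-trans (≤-reflexive (cong toℕ (sym corner-maxFalse))) (m≤n+m _ _)) (point≤sumCube A 𝟙)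
      where
      𝟙 = replicate n true
      corner-maxFalse : isMaxFalse (glue₀ (profile h₀ 𝟙) (profile h₁ 𝟙)) ≡ true
      corner-maxFalse = cong₂ _∧_ (cong not (h₀≡0 𝟙)) (cong₂ _∧_ (top-true ph₁ h₁≢0) (aboveTrue-𝟙 h₀))

  relevant-bound : ∣ relevant f ∣ ≤ 2 + kOffCorner
  relevant-bound = begin
    ∣ relevant f ∣                    ≡⟨ sym (∣relevant-toFront∣ f (suc i)) ⟩
    ∣ d ∷ e ∷ R ∣                     ≤⟨ ∣x∷p∣≤1+∣p∣ d (e ∷ R) ⟩
    1 + ∣ e ∷ R ∣                     ≤⟨ +-monoʳ-≤ 1 (∣x∷p∣≤1+∣p∣ e R) ⟩
    2 + ∣ (H₀ ∪ G₀) ∪ (H₁ ∪ G₁) ∣      ≡⟨ cong (λ r → 2 + ∣ (r ∪ G₀) ∪ (H₁ ∪ G₁) ∣) (relevant-≡0 h₀≡0) ⟩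
    2 + ∣ (∅ ∪ G₀) ∪ (H₁ ∪ G₁) ∣       ≡⟨ cong (λ r → 2 + ∣ r ∪ (H₁ ∪ G₁) ∣) (∪-identityˡ G₀) ⟩
    2 + ∣ G₀ ∪ (H₁ ∪ G₁) ∣             ≡⟨ cong (λ r → 2 + ∣ r ∣) (∪-left-swap G₀ H₁ G₁) ⟩
    2 + kOffCorner                    ∎
    where
    open ≤-Reasoning
    H₀ H₁ G₀ G₁ : Subset n
    H₀ = relevant h₀
    H₁ = relevant h₁
    G₀ = relevant g₀
    G₁ = relevant g₁
    R = (H₀ ∪ G₀) ∪ (H₁ ∪ G₁)
    d = differ (restrict f (suc i) false) (restrict f (suc i) true)
    e = differ h₀ g₀ ∨ differ h₁ g₁

  private
    corner-premises : ∀ x → T (CornerPremises (profile h₀ x) (profile g₀ x))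
    corner-premises x = Equivalence.from T-∧ (subst (T ∘ not) (sym (h₀≡0 x)) tt , ⇒ᵇ-intro (above-h₀ x))

  bound-distinct : differ h₁ g₁ ≡ true → differ g₁ g₀ ≡ true → 2 + ∣ relevant f ∣ ≤ extremalCount f
  bound-distinct h₁≢g₁ g₁≢g₀ = begin
    2 + ∣ relevant f ∣
      ≤⟨ +-monoʳ-≤ 2 relevant-bound ⟩
    2 + (2 + kOffCorner)
      ≤⟨ +-monoʳ-≤ 4 (∣p∪q∪r∣≤∣p∣+∣r─p∣+∣q─r∣ (relevant h₁) (relevant g₀) (relevant g₁)) ⟩
    4 + (∣ relevant h₁ ∣ + (W₁ + W₂))
      ≡⟨ rearrange ∣ relevant h₁ ∣ W₁ W₂ ⟩
    1 + ((1 + ∣ relevant h₁ ∣) + ((1 + W₁) + (1 + W₂)))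
      ≡⟨ cong₂ (λ a b → 1 + ((1 + ∣ relevant h₁ ∣) + ((toℕ a + W₁) + (toℕ b + W₂)))) (sym h₁≢g₁) (sym g₁≢g₀) ⟩
    1 + ((1 + ∣ relevant h₁ ∣) + ((toℕ (differ h₁ g₁) + W₁) + (toℕ (differ g₁ g₀) + W₂)))
      ≤⟨ +-monoʳ-≤ 1 (+-mono-≤ (relevant<extremalCount ph₁)
                              (+-mono-≤ (newRelevant-bound ph₁ pg₁ h₁≤g₁)
                                        (newRelevant-bound-reverse pg₁ pg₀ g₀≤g₁))) ⟩
    1 + (extremalCount h₁ + (newExtremalCount h₁ g₁ + newExtremalCount g₁ g₀))
      ≡⟨ cong (λ k → 1 + (extremalCount h₁ + k)) (sym (sumCube-distrib-+ ν₁ ν₂)) ⟩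
    1 + (extremalCount h₁ + sumCube (λ x → ν₁ x + ν₂ x))
      ≤⟨ +-monoʳ-≤ 1 (sumCube-+-≤ λ x →
           offCorner-table (profile h₀ x) (profile h₁ x) (profile g₀ x) (profile g₁ x)
                           (corner-premises x) (profile-mono g₀≤g₁ x) (profile-mono h₁≤g₁ x)) ⟩
    1 + sumCube offCorner
      ≤⟨ offCorner-bound ⟩
    extremalCount f ∎
    where
    open ≤-Reasoning
    W₁ = newRelevantCount h₁ g₁
    W₂ = newRelevantCount g₁ g₀
    ν₁ ν₂ : Vec Bool n → ℕ
    ν₁ x = newExtremalᵖ (profile h₁ x) (profile g₁ x)
    ν₂ x = newExtremalᵖ (profile g₁ x) (profile g₀ x)
    rearrange : ∀ a b c → 4 + (a + (b + c)) ≡ 1 + ((1 + a) + ((1 + b) + (1 + c)))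
    rearrange = solve 3 (λ a b c → con 4 :+ (a :+ (b :+ c))
                                := con 1 :+ ((con 1 :+ a) :+ ((con 1 :+ b) :+ (con 1 :+ c)))) refl

  private
    bound-via-glue : ∀ {u} → Positive u → u ≤ᶠ g₁ → ¬ ≡0 u → ¬ ≡1 g₁ →
      kOffCorner ≡ ∣ relevant u ∪ relevant g₁ ∣ →
      (∀ x → extremalᵖ (profile (glue u g₁) (false ∷ x)) + extremalᵖ (profile (glue u g₁) (true ∷ x))
               + toℕ (minTrue g₁ x ∧ minTrue u x) ≤ offCorner x) →
      2 + ∣ relevant f ∣ ≤ extremalCount f
    bound-via-glue {u} pu u≤g₁ u≢0 g₁≢1 kOffCorner≡ pointwise = begin
      2 + ∣ relevant f ∣
        ≤⟨ +-monoʳ-≤ 2 relevant-bound ⟩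
      1 + (3 + kOffCorner)
        ≡⟨ cong (λ k → 1 + (3 + k)) kOffCorner≡ ⟩
      1 + (3 + ∣ relevant u ∪ relevant g₁ ∣)
        ≤⟨ +-monoʳ-≤ 1 (glue-bound IH pu pg₁ u≤g₁ u≢0 g₁≢1 avoid) ⟩
      1 + (extremalCount (glue u g₁) + commonMinTrue u g₁)
        ≡⟨ cong (λ k → 1 + (k + commonMinTrue u g₁)) (sym (sumCube-distrib-+ ε₀ ε₁)) ⟩
      1 + (sumCube (λ x → ε₀ x + ε₁ x) + commonMinTrue u g₁)
        ≤⟨ +-monoʳ-≤ 1 (sumCube-+-≤ pointwise) ⟩
      1 + sumCube offCorner
        ≤⟨ offCorner-bound ⟩
      extremalCount f ∎
      where
      open ≤-Reasoning
      ε₀ ε₁ : Vec Bool n → ℕ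
      ε₀ x = extremalᵖ (profile (glue u g₁) (false ∷ x))
      ε₁ x = extremalᵖ (profile (glue u g₁) (true ∷ x))

  bound-g₀≗g₁ : differ g₁ g₀ ≡ false → 2 + ∣ relevant f ∣ ≤ extremalCount f
  bound-g₀≗g₁ g₁≡g₀ = bound-via-glue ph₁ h₁≤g₁ h₁≢0 g₁≢1 kOffCorner≡
    λ x → offCorner-table-g₀≗g₁ (profile h₀ x) (profile h₁ x) (profile g₀ x) (profile g₁ x) (corner-premises x)
            (profile-mono g₀≤g₁ x) (profile-mono (≗⇒≤ᶠ g₁≗g₀) x) (profile-mono h₁≤g₁ x)
    where
    g₁≗g₀ : g₁ ≗ g₀
    g₁≗g₀ = differ-false g₁≡g₀
    g₁≢1 : ¬ ≡1 g₁
    g₁≢1 g₁≡1 = g≢1 (restrictions-≡1 i (λ x → trans (sym (g₁≗g₀ x)) (g₁≡1 x)) g₁≡1)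
    kOffCorner≡ : kOffCorner ≡ ∣ relevant h₁ ∪ relevant g₁ ∣
    kOffCorner≡ = trans (cong (λ r → ∣ relevant h₁ ∪ (r ∪ relevant g₁) ∣) (relevant-cong (sym ∘ g₁≗g₀)))
               (cong (λ r → ∣ relevant h₁ ∪ r ∣) (∪-idem (relevant g₁)))

  bound-h₁≗g₁ : differ h₁ g₁ ≡ false → 2 + ∣ relevant f ∣ ≤ extremalCount f
  bound-h₁≗g₁ h₁≡g₁ = bound-via-glue pg₀ g₀≤g₁ g₀≢0 g₁≢1 kOffCorner≡
    λ x → offCorner-table-h₁≗g₁ (profile h₀ x) (profile h₁ x) (profile g₀ x) (profile g₁ x) (corner-premises x)
            (profile-mono g₀≤g₁ x) (profile-mono h₁≤g₁ x) (profile-mono (≗⇒≤ᶠ (sym ∘ h₁≗g₁)) x)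
    where
    h₁≗g₁ : h₁ ≗ g₁
    h₁≗g₁ = differ-false h₁≡g₁
    g₁≢1 : ¬ ≡1 g₁
    g₁≢1 g₁≡1 = h₁≢1 (λ x → trans (h₁≗g₁ x) (g₁≡1 x))
    kOffCorner≡ : kOffCorner ≡ ∣ relevant g₀ ∪ relevant g₁ ∣
    kOffCorner≡ = trans (cong (λ r → ∣ r ∪ (relevant g₀ ∪ relevant g₁) ∣) (relevant-cong h₁≗g₁))
         (cong ∣_∣ (trans (∪-left-swap (relevant g₁) (relevant g₀) (relevant g₁))
                          (cong (relevant g₀ ∪_) (∪-idem (relevant g₁)))))

  quadrant-bound : 2 + ∣ relevant f ∣ ≤ extremalCount f
  quadrant-bound with differ h₁ g₁ in h₁≢g₁ | differ g₁ g₀ in g₁≢g₀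
  ... | true  | true  = bound-distinct h₁≢g₁ g₁≢g₀
  ... | _     | false = bound-g₀≗g₁ g₁≢g₀
  ... | false | true  = bound-h₁≗g₁ h₁≢g₁

nonSplit-bound : ∀ {n} → NonSplitBound n
nonSplit-bound {zero} {f} pos ns with f (false ∷ []) in f₀
... | false = contradiction (λ { [] → f₀ }) (proj₁ (ns zero))
... | true  = contradiction (λ { [] → cof₀≤ᶠcof₁ pos [] f₀ }) (proj₂ (ns zero))
nonSplit-bound {suc n} {f} pos ns with any? (λ i → ≡0? (restrict (cof₀ f) i false))
... | yes (i , h₀≡0) = Quadrant.quadrant-bound nonSplit-bound pos ns i h₀≡0
... | no  none       = cofactor-step pos 2 (nonSplit-bound (Positive-cof₀ pos) h-nonSplit)
  where
  h-nonSplit : NonSplit (cof₀ f)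
  h-nonSplit j = (λ h₀≡0 → none (j , h₀≡0)) , restrict-cof₀-nonone pos j (proj₂ (ns (suc j)))

lemma4 : ∀ {m} (f : BF (ℕ.suc m)) →
    Positive f → Threshold f → NonSplit f →
    (∀ i → NonSplit (restrict f i Bool.false) ⊎ NonSplit (restrict f i Bool.true)) →
    (R : Subset (ℕ.suc m)) → (∀ j → (j ∈ R) ⇔ Relevant f j) →
    (E : List (Vec Bool (ℕ.suc m))) → Unique E →
    (∀ x → (x LM.∈ E) ⇔ Extremal f x) →
    ∣ R ∣ + 2 ≤ length E
lemma4 f pos _ ns _ R R⇔Relevant E _ E⇔Extremal = begin
  ∣ R ∣ + 2          ≡⟨ +-comm ∣ R ∣ 2 ⟩
  2 + ∣ R ∣          ≡⟨ cong (λ S → 2 + ∣ S ∣) (relevant-unique {f = f} R R⇔Relevant) ⟩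
  2 + ∣ relevant f ∣ ≤⟨ nonSplit-bound pos ns ⟩
  extremalCount f    ≤⟨ extremalCount≤length pos E E⇔Extremal ⟩
  length E           ∎
  where open ≤-Reasoning
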